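{- Let $\delta=\log\big((2/3)\,2^{2/3}\big)=0.05663\ldots$ (natural logarithm). If $H\cong(\mathbb{Z}/q\mathbb{Z})^n$ for some prime power $q$ and some $n\geq 0$, then every tricolored sum-free set in $H$ has cardinality at most $3\cdot\lvert H\rvert^{1-\frac{\delta}{\log q}}$.
   Context: A tricolored sum-free set in an abelian group $H$ (written additively) is a set $M\subseteq S\times T\times U$, where $S,T,U\subseteq H$, such that $M$ is a 3-dimensional perfect matching on $S\times T\times U$ (each of the three coordinate projections $M\to S$, $M\to T$, $M\to U$ is a bijection), $s+t+u=0$ for all $(s,t,u)\in M$, and $s+t+u\neq 0$ for all $(s,t,u)\in (S\times T\times U)\setminus M$. Its cardinality is $\lvert M\rvert$. -}

module Defs where

open import Data.Nat using (ℕ; zero; suc; _+_; _*_; _^_; _%_)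
open import Data.Nat.DivMod using (m%n<n)
open import Data.Nat.Primality using (Prime)
open import Data.Fin using (Fin; toℕ; fromℕ<)
open import Data.Vec using (Vec; zipWith)
open import Data.Vec.Relation.Unary.All using (All)
open import Data.Product using (∃; ∃-syntax; _×_)
open import Relation.Binary.PropositionalEquality using (_≡_)
open import Function.Definitions using (Injective)

IsPrimePower : ℕ → Set
IsPrimePower q = ∃[ p ] ∃[ k ] (Prime p × q ≡ p ^ suc k)

_+ᶻ_ : ∀ {q} → Fin q → Fin q → Fin q
_+ᶻ_ {suc q} a b = fromℕ< (m%n<n (toℕ a + toℕ b) (suc q))

H : ℕ → ℕ → Set
H q n = Vec (Fin q) n

_+ᴴ_ : ∀ {q n} → H q n → H q n → H q n
_+ᴴ_ = zipWith _+ᶻ_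

IsZero : ∀ {q n} → H q n → Set
IsZero = All (λ x → toℕ x ≡ 0)

-- A tricolored sum-free set M = {(s i, t i, u i) : i ∈ Fin m} of cardinality m
-- in H, with S, T, U the images of s, t, u. The three projections are
-- bijections onto S, T, U (i.e. s, t, u are injective); every triple of M
-- sums to zero; and a triple (s i, t j, u k) of S×T×U sums to zero only if
-- it lies in M, i.e. only if i = j = k.
record TricoloredSumFree (q n m : ℕ) : Set where
  field
    s t u  : Fin m → H q n
    s-inj  : Injective _≡_ _≡_ s
    t-inj  : Injective _≡_ _≡_ t
    u-inj  : Injective _≡_ _≡_ u
    sum-in : ∀ i → IsZero ((s i +ᴴ t i) +ᴴ u i)
    sum-out : ∀ i j k → IsZero ((s i +ᴴ t j) +ᴴ u k) → (i ≡ j × j ≡ k)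

module Submission where

-- The slice-rank method over 𝔽ₚ. Write q = p^(e+1) = L + 1. Because p divides (tq choose i) for
-- 0 < i < q, the binomial coefficient (w + L choose L) is ≡ 1 (mod p) when q ∣ w and ≡ 0 otherwise.
-- Hence the diagonal tensor [sᵢ + tⱼ + uₖ = 0] of a tricolored sum-free set of size m is congruent
-- to ∏ᵣ (xᵣ + yᵣ + zᵣ + L choose L), which Vandermonde's identity expands into products
-- (x choose a)(y choose b)(z + L choose c) with a + b + c = (L, …, L). One of a, b, c has total
-- degree ≤ nL/3, so grouping the terms gives a slice decomposition with 3N slices, N the number of
-- exponent vectors in [0, L]ⁿ of degree ≤ nL/3; since a diagonal tensor with nonzero diagonal has
-- slice rank m, m ≤ 3N. Finally, with A = 3L + 1 and B = 3L − 1, weighting each a ∈ [0, L]ⁿ by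
-- ∏ᵣ A^(L − aᵣ) B^(aᵣ) and using A^L ≤ 2B^L gives 32ⁿ N³ ≤ 27ⁿ q³ⁿ.

open import Algebra.Bundles using (CommutativeSemiring)

module AllVectors where

  open import Data.Fin.Base using (zero; suc)
  open import Data.List.Base using (List; []; _∷_; map; concatMap)
  open import Data.List.Membership.Propositional using (_∈_)
  open import Data.List.Membership.Propositional.Properties using (∈-map⁺; ∈-concatMap⁺)
  open import Data.List.Relation.Unary.Any as Any using (here)
  open import Data.Nat.Base using (ℕ; zero; suc)
  open import Data.Vec.Base using (Vec; []; _∷_; lookup)
  open import Function.Base using (_∘_)
  open import Relation.Binary.PropositionalEquality using (refl)

  allVectors : ∀ {a} {A : Set a} → List A → (n : ℕ) → List (Vec A n)
  allVectors xs zero    = [] ∷ []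
  allVectors xs (suc n) = concatMap (λ x → map (x ∷_) (allVectors xs n)) xs

  ∈-allVectors⁺ : ∀ {a} {A : Set a} (xs : List A) {n} (v : Vec A n) →
                  (∀ r → lookup v r ∈ xs) → v ∈ allVectors xs n
  ∈-allVectors⁺ xs []              _     = here refl
  ∈-allVectors⁺ xs {suc n} (x ∷ v) v⊆xs = ∈-concatMap⁺ (λ y → map (y ∷_) (allVectors xs n))
    (Any.map (λ { refl → ∈-map⁺ (x ∷_) (∈-allVectors⁺ xs v (v⊆xs ∘ suc)) }) (v⊆xs zero))

module FiniteSums {c ℓ} (R : CommutativeSemiring c ℓ) where

  open import Data.Fin.Base using (Fin; zero; suc)
  open import Data.Fin.Properties using (_≟_)
  open import Data.List.Base using (List; []; _∷_; _++_; map; concatMap)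
  open import Data.Nat.Base using (zero; suc)
  open import Data.Vec.Base using (_∷_; lookup)
  open import Function.Base using (_∘_)
  open import Function.Definitions using (Injective)
  open import Relation.Binary.PropositionalEquality as ≡ using (_≡_; _≢_)
  open import Relation.Nullary using (yes; no; contradiction)

  open AllVectors using (allVectors)
  open CommutativeSemiring R hiding (zero)
  open import Algebra.Properties.Semiring.Sum semiring public
  open import Algebra.Properties.CommutativeMonoid.Sum *-commutativeMonoid public
    using () renaming (sum to product; sum-cong-≗ to ∏-cong; ∑-distrib-+ to ∏-distrib-*)
  open import Algebra.Properties.CommutativeSemigroup +-commutativeSemigroup using (interchange)
  open import Relation.Binary.Reasoning.Setoid setoid

  infixl 10 product-syntax ∑ₗ-syntax

  product-syntax : ∀ n → (Fin n → Carrier) → Carrier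
  product-syntax _ = product

  syntax product-syntax n (λ i → x) = ∏[ i < n ] x

  ∑ₗ-syntax : ∀ {a} {A : Set a} → List A → (A → Carrier) → Carrier
  ∑ₗ-syntax []       f = 0#
  ∑ₗ-syntax (x ∷ xs) f = f x + ∑ₗ-syntax xs f

  syntax ∑ₗ-syntax xs (λ x → e) = ∑[ x ∈ xs ] e

  module _ {a} {A : Set a} where

    ∑ₗ-cong : ∀ (xs : List A) {f g : A → Carrier} → (∀ x → f x ≈ g x) →
              ∑[ x ∈ xs ] f x ≈ ∑[ x ∈ xs ] g x
    ∑ₗ-cong []       f≈g = refl
    ∑ₗ-cong (x ∷ xs) f≈g = +-cong (f≈g x) (∑ₗ-cong xs f≈g)

    ∑ₗ-zero : ∀ (xs : List A) → ∑[ x ∈ xs ] 0# ≈ 0#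
    ∑ₗ-zero []       = refl
    ∑ₗ-zero (x ∷ xs) = trans (+-identityˡ _) (∑ₗ-zero xs)

    ∑ₗ-++ : ∀ (xs ys : List A) (f : A → Carrier) →
            ∑[ x ∈ xs ++ ys ] f x ≈ ∑[ x ∈ xs ] f x + ∑[ y ∈ ys ] f y
    ∑ₗ-++ []       ys f = sym (+-identityˡ _)
    ∑ₗ-++ (x ∷ xs) ys f = trans (+-congˡ (∑ₗ-++ xs ys f)) (sym (+-assoc _ _ _))

    ∑ₗ-distrib-+ : ∀ (xs : List A) (f g : A → Carrier) →
                   ∑[ x ∈ xs ] (f x + g x) ≈ ∑[ x ∈ xs ] f x + ∑[ x ∈ xs ] g x
    ∑ₗ-distrib-+ []       f g = sym (+-identityˡ 0#)
    ∑ₗ-distrib-+ (x ∷ xs) f g = trans (+-congˡ (∑ₗ-distrib-+ xs f g)) (interchange _ _ _ _)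

    *-distribˡ-∑ₗ : ∀ k (xs : List A) (f : A → Carrier) → k * ∑[ x ∈ xs ] f x ≈ ∑[ x ∈ xs ] (k * f x)
    *-distribˡ-∑ₗ k []       f = zeroʳ k
    *-distribˡ-∑ₗ k (x ∷ xs) f = trans (distribˡ k (f x) _) (+-congˡ (*-distribˡ-∑ₗ k xs f))

    *-distribʳ-∑ₗ : ∀ k (xs : List A) (f : A → Carrier) → ∑[ x ∈ xs ] f x * k ≈ ∑[ x ∈ xs ] (f x * k)
    *-distribʳ-∑ₗ k xs f =
      trans (*-comm _ k) (trans (*-distribˡ-∑ₗ k xs f) (∑ₗ-cong xs (λ x → *-comm k (f x))))

    ∑-∑ₗ-comm : ∀ {n} (xs : List A) (f : Fin n → A → Carrier) →
                ∑[ i < n ] ∑[ x ∈ xs ] f i x ≈ ∑[ x ∈ xs ] ∑[ i < n ] f i x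
    ∑-∑ₗ-comm {zero}  xs f = sym (∑ₗ-zero xs)
    ∑-∑ₗ-comm {suc n} xs f = trans (+-congˡ (∑-∑ₗ-comm xs (f ∘ suc)))
      (sym (∑ₗ-distrib-+ xs (f zero) (λ x → ∑[ i < n ] f (suc i) x)))

  module _ {a b} {A : Set a} {B : Set b} where

    ∑ₗ-map : ∀ (g : A → B) (xs : List A) (f : B → Carrier) →
             ∑[ y ∈ map g xs ] f y ≈ ∑[ x ∈ xs ] f (g x)
    ∑ₗ-map g []       f = refl
    ∑ₗ-map g (x ∷ xs) f = +-congˡ (∑ₗ-map g xs f)

    ∑ₗ-concatMap : ∀ (g : A → List B) (xs : List A) (f : B → Carrier) →
                   ∑[ y ∈ concatMap g xs ] f y ≈ ∑[ x ∈ xs ] ∑[ y ∈ g x ] f y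
    ∑ₗ-concatMap g []       f = refl
    ∑ₗ-concatMap g (x ∷ xs) f =
      trans (∑ₗ-++ (g x) (concatMap g xs) f) (+-congˡ (∑ₗ-concatMap g xs f))

  ∏∑ₗ≈∑ₗ∏ : ∀ {a} {A : Set a} n (xs : List A) (f : Fin n → A → Carrier) →
            ∏[ r < n ] ∑[ x ∈ xs ] f r x ≈ ∑[ v ∈ allVectors xs n ] ∏[ r < n ] f r (lookup v r)
  ∏∑ₗ≈∑ₗ∏ zero    xs f = sym (+-identityʳ 1#)
  ∏∑ₗ≈∑ₗ∏ (suc n) xs f = begin
    ∑[ x ∈ xs ] f zero x * ∏[ r < n ] ∑[ x ∈ xs ] f (suc r) x
      ≈⟨ *-congˡ (∏∑ₗ≈∑ₗ∏ n xs (f ∘ suc)) ⟩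
    ∑[ x ∈ xs ] f zero x * ∑[ v ∈ tails ] ∏[ r < n ] f (suc r) (lookup v r)
      ≈⟨ *-distribʳ-∑ₗ _ xs (f zero) ⟩
    ∑[ x ∈ xs ] (f zero x * ∑[ v ∈ tails ] ∏[ r < n ] f (suc r) (lookup v r))
      ≈⟨ ∑ₗ-cong xs (λ x → trans (*-distribˡ-∑ₗ (f zero x) tails _) (sym (∑ₗ-map (x ∷_) tails _))) ⟩
    ∑[ x ∈ xs ] ∑[ v ∈ map (x ∷_) tails ] ∏[ r < suc n ] f r (lookup v r)
      ≈⟨ sym (∑ₗ-concatMap (λ x → map (x ∷_) tails) xs _) ⟩
    ∑[ v ∈ allVectors xs (suc n) ] ∏[ r < suc n ] f r (lookup v r) ∎
    where tails = allVectors xs n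

  δ : ∀ {n} → Fin n → Fin n → Carrier
  δ zero    zero    = 1#
  δ zero    (suc j) = 0#
  δ (suc i) zero    = 0#
  δ (suc i) (suc j) = δ i j

  δ-refl : ∀ {n} (i : Fin n) → δ i i ≈ 1#
  δ-refl zero    = refl
  δ-refl (suc i) = δ-refl i

  δ-≢ : ∀ {n} {i j : Fin n} → i ≢ j → δ i j ≈ 0#
  δ-≢ {i = zero}  {zero}  i≢j = contradiction ≡.refl i≢j
  δ-≢ {i = zero}  {suc j} i≢j = refl
  δ-≢ {i = suc i} {zero}  i≢j = refl
  δ-≢ {i = suc i} {suc j} i≢j = δ-≢ (i≢j ∘ ≡.cong suc)

  δ-injective : ∀ {d n} {f : Fin d → Fin n} → Injective _≡_ _≡_ f → ∀ a b → δ (f a) (f b) ≈ δ a b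
  δ-injective {f = f} f-inj a b with a ≟ b
  ... | yes ≡.refl = trans (δ-refl (f a)) (sym (δ-refl a))
  ... | no a≢b     = trans (δ-≢ (a≢b ∘ f-inj)) (sym (δ-≢ a≢b))

  ∑-δ : ∀ {n} (i : Fin n) (f : Fin n → Carrier) → ∑[ j < n ] (δ i j * f j) ≈ f i
  ∑-δ {suc n} zero    f = begin
    1# * f zero + ∑[ j < n ] (0# * f (suc j))
      ≈⟨ +-cong (*-identityˡ _) (trans (sum-cong-≋ {n} (λ j → zeroˡ _)) (sum-replicate-zero n)) ⟩
    f zero + 0#
      ≈⟨ +-identityʳ _ ⟩
    f zero ∎
  ∑-δ {suc n} (suc i) f = begin
    0# * f zero + ∑[ j < n ] (δ i j * f (suc j)) ≈⟨ +-cong (zeroˡ _) (∑-δ i (f ∘ suc)) ⟩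
    0# + f (suc i)                              ≈⟨ +-identityˡ _ ⟩
    f (suc i)                                   ∎

module IntegerSums where

  open import Data.Fin.Base using (Fin; zero; suc)
  open import Data.Fin.Properties using (_≟_)
  open import Data.Integer.Base using (ℤ; +_; 0ℤ; 1ℤ; _+_; _*_; -_; _-_)
  open import Data.Integer.Divisibility.Signed
  import Data.Integer.Properties as ℤ
  open import Data.Integer.Tactic.RingSolver using (solve-∀)
  open import Data.List.Base using (List; []; _∷_)
  open import Data.Nat.Base using (ℕ; zero; suc)
  open import Data.Vec.Functional using (Vector)
  open import Function.Base using (_∘_)
  open import Relation.Binary.PropositionalEquality using (_≡_; _≢_; refl; sym; trans; cong; cong₂; subst)
  open import Relation.Nullary using (yes; no)

  open FiniteSums ℤ.+-*-commutativeSemiring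

  ∣0 : ∀ {d} → d ∣ 0ℤ
  ∣0 = divides 0ℤ refl

  ∣-∑ : ∀ {d n} {f : Fin n → ℤ} → (∀ i → d ∣ f i) → d ∣ ∑[ i < n ] f i
  ∣-∑ {n = zero}  d∣f = ∣0
  ∣-∑ {n = suc n} d∣f = ∣m∣n⇒∣m+n (d∣f zero) (∣-∑ (d∣f ∘ suc))

  ∣-∑ₗ : ∀ {a} {A : Set a} {d} (xs : List A) {f : A → ℤ} → (∀ x → d ∣ f x) → d ∣ ∑[ x ∈ xs ] f x
  ∣-∑ₗ []       d∣f = ∣0
  ∣-∑ₗ (x ∷ xs) d∣f = ∣m∣n⇒∣m+n (d∣f x) (∣-∑ₗ xs d∣f)

  ∑-neg : ∀ {n} (f : Fin n → ℤ) → ∑[ i < n ] (- f i) ≡ - ∑[ i < n ] f i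
  ∑-neg {zero}  f = refl
  ∑-neg {suc n} f = trans (cong (_+_ (- f zero)) (∑-neg (f ∘ suc))) (sym (ℤ.neg-distrib-+ (f zero) _))

  ∑-distrib-minus : ∀ {n} (f g : Fin n → ℤ) → ∑[ i < n ] (f i - g i) ≡ ∑[ i < n ] f i - ∑[ i < n ] g i
  ∑-distrib-minus {n} f g = trans (∑-distrib-+ {n} f (λ i → - g i)) (cong (_+_ (∑[ i < n ] f i)) (∑-neg g))

  ∑-minus-term : ∀ {n} (f : Fin n → ℤ) b → ∑[ a < n ] f a - f b ≡ ∑[ a < n ] (f a - δ b a * f a)
  ∑-minus-term {n} f b =
    sym (trans (∑-distrib-minus f (λ a → δ b a * f a)) (cong (_-_ (∑[ a < n ] f a)) (∑-δ b f)))

  ∣-∑-minus-term : ∀ {d n} {f : Fin n → ℤ} b → (∀ {a} → a ≢ b → d ∣ f a) → d ∣ ∑[ a < n ] f a - f b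
  ∣-∑-minus-term {d} {f = f} b d∣f = subst (d ∣_) (sym (∑-minus-term f b)) (∣-∑ term)
    where
    term : ∀ a → d ∣ f a - δ b a * f a
    term a with a ≟ b
    ... | yes refl rewrite δ-refl b          = subst (d ∣_) (sym (x-1x≡0 (f b))) ∣0
      where
      x-1x≡0 : ∀ x → x - 1ℤ * x ≡ 0ℤ
      x-1x≡0 = solve-∀
    ... | no a≢b   rewrite δ-≢ (a≢b ∘ sym) = subst (d ∣_) (sym (ℤ.+-identityʳ (f a))) (d∣f a≢b)

  infix 4 _≡_mod_

  _≡_mod_ : ℤ → ℤ → ℕ → Set
  x ≡ y mod n = + n ∣ x - y

  ≡-mod-∣ : ∀ {x y n} → x ≡ y mod n → + n ∣ y → + n ∣ x
  ≡-mod-∣ x≡y n∣y = ∣m+n∣n⇒∣m x≡y (∣m⇒∣-m n∣y)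

  ≡-mod-sym : ∀ {x y n} → x ≡ y mod n → y ≡ x mod n
  ≡-mod-sym {x} {y} x≡y = subst (_ ∣_) (neg-difference x y) (∣m⇒∣-m x≡y)
    where
    neg-difference : ∀ x y → - (x - y) ≡ y - x
    neg-difference = solve-∀

  ∏-cong-mod : ∀ {n d} (f g : Fin n → ℤ) → (∀ r → f r ≡ g r mod d) →
               ∏[ r < n ] f r ≡ ∏[ r < n ] g r mod d
  ∏-cong-mod {zero}      f g f≡g = ∣0
  ∏-cong-mod {suc n} {d} f g f≡g = subst (+ d ∣_) (telescoping (f zero) (g zero) F G)
    (∣m∣n⇒∣m+n (∣m⇒∣m*n F (f≡g zero)) (∣n⇒∣m*n (g zero) (∏-cong-mod (f ∘ suc) (g ∘ suc) (f≡g ∘ suc))))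
    where
    F = ∏[ r < n ] f (suc r)
    G = ∏[ r < n ] g (suc r)
    telescoping : ∀ a b x y → (a - b) * x + b * (x - y) ≡ a * x - b * y
    telescoping = solve-∀

  infix 8 _·_

  _·_ : ∀ {m} → Vector ℤ m → Vector ℤ m → ℤ
  _·_ {m} u v = ∑[ i < m ] (u i * v i)

  ·-comm : ∀ {m} (u v : Vector ℤ m) → u · v ≡ v · u
  ·-comm u v = sum-cong-≗ (λ i → ℤ.*-comm (u i) (v i))

  ·-congˡ : ∀ {m} (u : Vector ℤ m) {f g : Vector ℤ m} → (∀ i → f i ≡ g i) → u · f ≡ u · g
  ·-congˡ u f≗g = sum-cong-≗ (λ i → cong (u i *_) (f≗g i))

  ·-distribˡ-+ : ∀ {m} (u f g : Vector ℤ m) → u · (λ i → f i + g i) ≡ u · f + u · g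
  ·-distribˡ-+ {m} u f g = trans (sum-cong-≗ (λ i → ℤ.*-distribˡ-+ (u i) (f i) (g i))) (∑-distrib-+ {m} _ _)

  ·-distribˡ-minus : ∀ {m} (u f g : Vector ℤ m) → u · (λ i → f i - g i) ≡ u · f - u · g
  ·-distribˡ-minus {m} u f g =
    trans (sum-cong-≗ (λ i → x[y-z]≡xy-xz (u i) (f i) (g i))) (∑-distrib-minus (λ i → u i * f i) (λ i → u i * g i))
    where
    x[y-z]≡xy-xz : ∀ x y z → x * (y - z) ≡ x * y - x * z
    x[y-z]≡xy-xz = solve-∀

  ·-distribˡ-∑ : ∀ {m N} (u : Vector ℤ m) (f : Fin N → Vector ℤ m) →
                 u · (λ i → ∑[ r < N ] f r i) ≡ ∑[ r < N ] (u · f r)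
  ·-distribˡ-∑ {m} {N} u f =
    trans (sum-cong-≗ (λ i → *-distribˡ-sum {N} (u i) (λ r → f r i))) (∑-comm {m} {N} _)

  ·-scaleʳ : ∀ {m} (u g : Vector ℤ m) c → u · (λ i → c * g i) ≡ c * (u · g)
  ·-scaleʳ {m} u g c = trans (sum-cong-≗ (λ i → xcy≡cxy (u i) c (g i))) (sym (*-distribˡ-sum {m} c _))
    where
    xcy≡cxy : ∀ x c y → x * (c * y) ≡ c * (x * y)
    xcy≡cxy = solve-∀

  ·-combination : ∀ {m} (ℓ u v : Vector ℤ m) a b →
                  ℓ · (λ i → a * u i - b * v i) ≡ a * (ℓ · u) - b * (ℓ · v)
  ·-combination ℓ u v a b = trans (·-distribˡ-minus ℓ _ _) (cong₂ _-_ (·-scaleʳ ℓ u a) (·-scaleʳ ℓ v b))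

  ·-δ : ∀ {m} (u : Vector ℤ m) a → u · δ a ≡ u a
  ·-δ u a = trans (·-comm u (δ a)) (∑-δ a u)

  ∣-·ʳ : ∀ {d m} (u g : Vector ℤ m) → (∀ i → d ∣ g i) → d ∣ u · g
  ∣-·ʳ u g d∣g = ∣-∑ (λ i → ∣n⇒∣m*n (u i) (d∣g i))

module SliceRank where

  open import Data.Fin.Base using (Fin; zero; suc; punchIn; _↑ˡ_; _↑ʳ_)
  open import Data.Fin.Properties using (¬∀⟶∃¬; all?; punchIn-injective; punchInᵢ≢i)
  open import Data.Integer.Base as ℤ using (ℤ; +_; 0ℤ; 1ℤ; _+_; _*_; -_; _-_)
  open import Data.Integer.Divisibility.Signed
  import Data.Integer.Properties as ℤ
  open import Data.Integer.Tactic.RingSolver using (solve-∀)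
  open import Data.List.Base using (List)
  open import Data.Nat.Base as ℕ using (ℕ; zero; suc; _≤_; _<_)
  open import Data.Nat.Divisibility as ℕ∣ using ()
  open import Data.Nat.Primality using (Prime; euclidsLemma; ¬prime[1])
  open import Data.Nat.Properties as ℕ using ()
  open import Data.Product using (∃-syntax; _×_; _,_)
  open import Data.Sum as Sum using (_⊎_; [_,_]′)
  open import Data.Vec.Functional using (Vector; _++_)
  open import Data.Vec.Functional.Properties using (lookup-++ˡ; lookup-++ʳ)
  open import Function.Base using (_∘_)
  open import Function.Definitions using (Injective)
  open import Relation.Binary.PropositionalEquality as ≡ using (_≡_; _≢_; refl; sym; trans; cong; cong₂; subst)
  open import Relation.Nullary using (¬_; yes; no; contradiction)

  open FiniteSums ℤ.+-*-commutativeSemiring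
  open IntegerSums

  diagonal : ∀ {m} → Fin m → Fin m → Fin m → ℤ
  diagonal i j k = δ j i * δ j k

  record SliceDecomposition (m N₁ N₂ N₃ : ℕ) : Set where
    field
      X : Fin N₁ → Vector ℤ m
      F : Fin N₁ → Fin m → Fin m → ℤ
      Y : Fin N₂ → Vector ℤ m
      G : Fin N₂ → Fin m → Fin m → ℤ
      W : Fin N₃ → Vector ℤ m
      H : Fin N₃ → Fin m → Fin m → ℤ

    slices₁ slices₂ slices₃ tensor : Fin m → Fin m → Fin m → ℤ
    slices₁ i j k = ∑[ r < N₁ ] (X r i * F r j k)
    slices₂ i j k = ∑[ r < N₂ ] (Y r j * G r i k)
    slices₃ i j k = ∑[ r < N₃ ] (W r k * H r i j)
    tensor  i j k = slices₁ i j k + slices₂ i j k + slices₃ i j k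

  module Contraction {m d} (v : Vector ℤ m) (u : Vector ℤ d) (pivot : Fin d → Fin m) (a : Fin m) where

    contract : (Fin m → Fin m → Fin m → ℤ) → ℤ
    contract T = u · (λ k → v · (λ i → T i a (pivot k)))

    contract-+ : ∀ S T → contract (λ i j k → S i j k + T i j k) ≡ contract S + contract T
    contract-+ S T = trans (·-congˡ u (λ k → ·-distribˡ-+ v (λ i → S i a (pivot k)) (λ i → T i a (pivot k))))
                           (·-distribˡ-+ u _ _)

    contract-minus : ∀ S T → contract (λ i j k → S i j k - T i j k) ≡ contract S - contract T
    contract-minus S T = trans (·-congˡ u (λ k → ·-distribˡ-minus v (λ i → S i a (pivot k)) (λ i → T i a (pivot k))))
                           (·-distribˡ-minus u _ _)

    contract-∑ : ∀ {N} (S : Fin N → Fin m → Fin m → Fin m → ℤ) →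
                 contract (λ i j k → ∑[ r < N ] S r i j k) ≡ ∑[ r < N ] contract (S r)
    contract-∑ S = trans (·-congˡ u (λ k → ·-distribˡ-∑ v (λ r i → S r i a (pivot k))))
      (·-distribˡ-∑ u (λ r k → v · (λ i → S r i a (pivot k))))

    ∣-contract : ∀ {e} T → (∀ i k → e ∣ T i a k) → e ∣ contract T
    ∣-contract T e∣T = ∣-·ʳ u _ (λ k → ∣-·ʳ v _ (λ i → e∣T i (pivot k)))

    contract-cong : ∀ {n} S T → (∀ i j k → S i j k ≡ T i j k mod n) → contract S ≡ contract T mod n
    contract-cong S T S≡T =
      subst (_ ∣_) (contract-minus S T) (∣-contract (λ i j k → S i j k - T i j k) (λ i k → S≡T i a k))

    ∣-contract-slice₁ : ∀ {e} (x : Vector ℤ m) (f : Fin m → Fin m → ℤ) → e ∣ x · v →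
                        e ∣ contract (λ i j k → x i * f j k)
    ∣-contract-slice₁ {e} x f e∣x·v =
      ∣-·ʳ u _ (λ k → subst (e ∣_) (sym (inner k)) (∣n⇒∣m*n (f a (pivot k)) e∣x·v))
      where
      inner : ∀ k → v · (λ i → x i * f a (pivot k)) ≡ f a (pivot k) * (x · v)
      inner k = trans (·-congˡ v (λ i → ℤ.*-comm (x i) (f a (pivot k))))
        (trans (·-scaleʳ v x (f a (pivot k))) (cong (f a (pivot k) *_) (·-comm v x)))

    ∣-contract-slice₂ : ∀ {e} (y : Vector ℤ m) (g : Fin m → Fin m → ℤ) →
                        e ∣ (λ k → v · (λ i → g i (pivot k))) · u → e ∣ contract (λ i j k → y j * g i k)
    ∣-contract-slice₂ {e} y g e∣g·u = subst (e ∣_) (sym outer) (∣n⇒∣m*n (y a) e∣g·u)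
      where
      outer : contract (λ i j k → y j * g i k) ≡ y a * ((λ k → v · (λ i → g i (pivot k))) · u)
      outer = trans (·-congˡ u (λ k → ·-scaleʳ v _ (y a)))
                    (trans (·-scaleʳ u _ (y a)) (cong (y a *_) (·-comm u _)))

    ∣-contract-slice₃ : ∀ {e} (w : Vector ℤ m) (h : Fin m → Fin m → ℤ) →
                        e ∣ (λ k → w (pivot k)) · u → e ∣ contract (λ i j k → w k * h i j)
    ∣-contract-slice₃ {e} w h e∣w·u = subst (e ∣_) (sym outer) (∣n⇒∣m*n (v · (λ i → h i a)) e∣w·u)
      where
      outer : contract (λ i j k → w k * h i j) ≡ v · (λ i → h i a) * ((λ k → w (pivot k)) · u)
      outer = trans (·-congˡ u (λ k → trans (·-scaleʳ v _ (w (pivot k))) (ℤ.*-comm (w (pivot k)) _)))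
                    (trans (·-scaleʳ u (λ k → w (pivot k)) (v · (λ i → h i a)))
                           (cong (v · (λ i → h i a) *_) (·-comm u _)))

    contract-diagonal : Injective _≡_ _≡_ pivot → ∀ j₀ → a ≡ pivot j₀ → contract diagonal ≡ v a * u j₀
    contract-diagonal pivot-injective j₀ refl = begin
      u · (λ k → v · (λ i → δ a i * δ a (pivot k)))
        ≡⟨ ·-congˡ u (λ k → trans (·-congˡ v (λ i → ℤ.*-comm (δ a i) _)) (·-scaleʳ v (δ a) (δ a (pivot k)))) ⟩
      u · (λ k → δ a (pivot k) * (v · δ a))
        ≡⟨ ·-congˡ u (λ k → cong₂ _*_ (δ-injective pivot-injective j₀ k) (·-δ v a)) ⟩
      u · (λ k → δ j₀ k * v a)
        ≡⟨ ·-congˡ u (λ k → ℤ.*-comm (δ j₀ k) (v a)) ⟩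
      u · (λ k → v a * δ j₀ k)
        ≡⟨ ·-scaleʳ u (δ j₀) (v a) ⟩
      v a * (u · δ j₀)
        ≡⟨ cong (v a *_) (·-δ u j₀) ⟩
      v a * u j₀ ∎
      where open ≡.≡-Reasoning

    ∣-contract-tensor : ∀ {e N₁ N₂ N₃} (D : SliceDecomposition m N₁ N₂ N₃) → let open SliceDecomposition D in
                        (∀ r → e ∣ X r · v) → (∀ r → e ∣ (λ k → v · (λ i → G r i (pivot k))) · u) →
                        (∀ r → e ∣ (λ k → W r (pivot k)) · u) → e ∣ contract tensor
    ∣-contract-tensor {e} {N₁} {N₂} {N₃} D e∣X·v e∣G·u e∣W·u =
      subst (e ∣_) (sym additivity) (∣m∣n⇒∣m+n (∣m∣n⇒∣m+n e∣slices₁ e∣slices₂) e∣slices₃)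
      where
      open SliceDecomposition D
      additivity : contract tensor ≡ contract slices₁ + contract slices₂ + contract slices₃
      additivity = trans (contract-+ (λ i j k → slices₁ i j k + slices₂ i j k) slices₃)
                         (cong (_+ contract slices₃) (contract-+ slices₁ slices₂))
      e∣slices₁ : e ∣ contract slices₁
      e∣slices₁ = subst (e ∣_) (sym (contract-∑ (λ r i j k → X r i * F r j k)))
                    (∣-∑ (λ r → ∣-contract-slice₁ (X r) (F r) (e∣X·v r)))
      e∣slices₂ : e ∣ contract slices₂
      e∣slices₂ = subst (e ∣_) (sym (contract-∑ (λ r i j k → Y r j * G r i k)))
                    (∣-∑ (λ r → ∣-contract-slice₂ (Y r) (G r) (e∣G·u r)))
      e∣slices₃ : e ∣ contract slices₃
      e∣slices₃ = subst (e ∣_) (sym (contract-∑ (λ r i j k → W r k * H r i j)))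
                    (∣-∑ (λ r → ∣-contract-slice₃ (W r) (H r) (e∣W·u r)))

  module ModPrime {p : ℕ} (p-prime : Prime p) where

    p∤1 : ¬ + p ∣ 1ℤ
    p∤1 p∣1 with ℕ∣.∣1⇒≡1 (∣⇒∣ᵤ p∣1)
    ... | refl = ¬prime[1] p-prime

    p∣m*n⇒p∣m⊎p∣n : ∀ m n → + p ∣ m * n → + p ∣ m ⊎ + p ∣ n
    p∣m*n⇒p∣m⊎p∣n m n p∣mn = Sum.map ∣ᵤ⇒∣ ∣ᵤ⇒∣
      (euclidsLemma ℤ.∣ m ∣ ℤ.∣ n ∣ p-prime (subst (p ℕ∣.∣_) (ℤ.abs-* m n) (∣⇒∣ᵤ p∣mn)))

    p∤m⇒p∤n⇒p∤m*n : ∀ {m n} → ¬ + p ∣ m → ¬ + p ∣ n → ¬ + p ∣ m * n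
    p∤m⇒p∤n⇒p∤m*n {m} {n} p∤m p∤n = [ p∤m , p∤n ]′ ∘ p∣m*n⇒p∣m⊎p∣n m n

    record PivotedFamily {m s} (forms : Fin s → Vector ℤ m) (d : ℕ) : Set where
      field
        vec             : Fin d → Vector ℤ m
        pivot           : Fin d → Fin m
        pivot-injective : Injective _≡_ _≡_ pivot
        forms·vec       : ∀ r a → + p ∣ forms r · vec a
        vec-off-pivot   : ∀ {a b} → a ≢ b → + p ∣ vec a (pivot b)
        vec-at-pivot    : ∀ a → ¬ + p ∣ vec a (pivot a)

    unitVectors : ∀ {m} {forms : Fin 0 → Vector ℤ m} → PivotedFamily forms m
    unitVectors = record
      { vec             = δ
      ; pivot           = λ a → a
      ; pivot-injective = λ eq → eq
      ; forms·vec       = λ ()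
      ; vec-off-pivot   = λ a≢b → subst (+ p ∣_) (sym (δ-≢ a≢b)) ∣0
      ; vec-at-pivot    = λ a → p∤1 ∘ subst (+ p ∣_) (δ-refl a)
      }

    module _ {m s d} {forms : Fin (suc s) → Vector ℤ m} (F : PivotedFamily (forms ∘ suc) d) where

      open PivotedFamily F

      extend : (∀ a → + p ∣ forms zero · vec a) → PivotedFamily forms d
      extend ℓ·vec = record
        { vec             = vec
        ; pivot           = pivot
        ; pivot-injective = pivot-injective
        ; forms·vec       = λ { zero a → ℓ·vec a ; (suc r) a → forms·vec r a }
        ; vec-off-pivot   = vec-off-pivot
        ; vec-at-pivot    = vec-at-pivot
        }

    module _ {m s d} {forms : Fin (suc s) → Vector ℤ m} (F : PivotedFamily (forms ∘ suc) (suc d)) where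

      open PivotedFamily F

      eliminate : (a₀ : Fin (suc d)) → ¬ + p ∣ forms zero · vec a₀ → PivotedFamily forms d
      eliminate a₀ p∤λ₀ = record
        { vec             = vec′
        ; pivot           = pivot ∘ punchIn a₀
        ; pivot-injective = punchIn-injective a₀ _ _ ∘ pivot-injective
        ; forms·vec       = λ { zero b → ℓ·vec′ b ; (suc r) b → forms·vec′ r b }
        ; vec-off-pivot   = λ {a} {b} a≢b → ∣m∣n⇒∣m-n (∣n⇒∣m*n λ₀ (vec-off-pivot (a≢b ∘ punchIn-injective a₀ a b)))
                                                     (∣n⇒∣m*n (ℓ · old a) (a₀-off-pivot b))
        ; vec-at-pivot    = λ a p∣vec′ → p∤m⇒p∤n⇒p∤m*n p∤λ₀ (vec-at-pivot (punchIn a₀ a))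
            (∣m+n∣n⇒∣m p∣vec′ (∣m⇒∣-m (∣n⇒∣m*n (ℓ · old a) (a₀-off-pivot a))))
        }
        where
        ℓ = forms zero
        λ₀ = ℓ · vec a₀
        old : Fin d → Vector ℤ m
        old b = vec (punchIn a₀ b)
        vec′ : Fin d → Vector ℤ m
        vec′ b i = λ₀ * old b i - (ℓ · old b) * vec a₀ i
        ℓ·vec′ : ∀ b → + p ∣ ℓ · vec′ b
        ℓ·vec′ b = subst (+ p ∣_)
          (sym (trans (·-combination ℓ (old b) (vec a₀) λ₀ (ℓ · old b)) (xy-yx≡0 λ₀ (ℓ · old b)))) ∣0
          where
          xy-yx≡0 : ∀ x y → x * y - y * x ≡ 0ℤ
          xy-yx≡0 = solve-∀
        forms·vec′ : ∀ r b → + p ∣ forms (suc r) · vec′ b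
        forms·vec′ r b = subst (+ p ∣_) (sym (·-combination (forms (suc r)) (old b) (vec a₀) λ₀ (ℓ · old b)))
          (∣m∣n⇒∣m-n (∣n⇒∣m*n λ₀ (forms·vec r _)) (∣n⇒∣m*n (ℓ · old b) (forms·vec r a₀)))
        a₀-off-pivot : ∀ b → + p ∣ vec a₀ (pivot (punchIn a₀ b))
        a₀-off-pivot b = vec-off-pivot (punchInᵢ≢i a₀ b ∘ sym)

    addForm : ∀ {m s d} {forms : Fin (suc s) → Vector ℤ m} → PivotedFamily (forms ∘ suc) d →
              ∃[ d′ ] (d ≤ suc d′ × PivotedFamily forms d′)
    addForm {d = d} {forms} F with all? (λ a → + p ∣? forms zero · PivotedFamily.vec F a)
    ... | yes ℓ·vec = d , ℕ.n≤1+n d , extend F ℓ·vec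
    ... | no ¬ℓ·vec = eliminateAt F (¬∀⟶∃¬ d _ (λ a → + p ∣? forms zero · PivotedFamily.vec F a) ¬ℓ·vec)
      where
      eliminateAt : ∀ {d} (F : PivotedFamily (forms ∘ suc) d) →
                    ∃[ a ] ¬ + p ∣ forms zero · PivotedFamily.vec F a → ∃[ d′ ] (d ≤ suc d′ × PivotedFamily forms d′)
      eliminateAt {suc d} F (a₀ , p∤λ₀) = d , ℕ.≤-refl , eliminate F a₀ p∤λ₀

    pivotedFamily : ∀ {m s} (forms : Fin s → Vector ℤ m) → ∃[ d ] (m ≤ d ℕ.+ s × PivotedFamily forms d)
    pivotedFamily {m} {zero}  forms = m , ℕ.≤-reflexive (sym (ℕ.+-identityʳ m)) , unitVectors
    pivotedFamily {m} {suc s} forms with pivotedFamily (forms ∘ suc)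
    ... | d , m≤d+s , F with addForm F
    ...   | d′ , d≤1+d′ , F′ =
      d′ , ℕ.≤-trans m≤d+s (ℕ.≤-trans (ℕ.+-monoˡ-≤ s d≤1+d′) (ℕ.≤-reflexive (sym (ℕ.+-suc d′ s)))) , F′

    module _ {m s d} {forms : Fin s → Vector ℤ m} (F : PivotedFamily forms d) where

      open PivotedFamily F

      pivotSum : Vector ℤ m
      pivotSum i = ∑[ a < d ] vec a i

      forms·pivotSum : ∀ r → + p ∣ forms r · pivotSum
      forms·pivotSum r = subst (+ p ∣_) (sym swap) (∣-∑ (forms·vec r))
        where
        swap : forms r · pivotSum ≡ ∑[ a < d ] (forms r · vec a)
        swap = trans (sum-cong-≗ (λ i → *-distribˡ-sum {d} (forms r i) (λ a → vec a i)))
                     (∑-comm {m} {d} _)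

      pivotSum-at-pivot : ∀ b → ¬ + p ∣ pivotSum (pivot b)
      pivotSum-at-pivot b p∣sum = vec-at-pivot b
        (subst (+ p ∣_) (x-[x-y]≡y (pivotSum (pivot b)) (vec b (pivot b)))
          (∣m∣n⇒∣m-n p∣sum (∣-∑-minus-term {f = λ a → vec a (pivot b)} b vec-off-pivot)))
        where
        x-[x-y]≡y : ∀ x y → x - (x - y) ≡ y
        x-[x-y]≡y = solve-∀

    nonzeroKernelVector : ∀ {m s} (forms : Fin s → Vector ℤ m) → s < m →
                          ∃[ u ] ∃[ j ] ((∀ r → + p ∣ forms r · u) × ¬ + p ∣ u j)
    nonzeroKernelVector {m} {s} forms s<m with pivotedFamily forms
    ... | zero  , m≤s , F = contradiction m≤s (ℕ.<⇒≱ s<m)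
    ... | suc d , _   , F = vec zero , pivot zero , (λ r → forms·vec r zero) , vec-at-pivot zero
      where open PivotedFamily F

    sliceRank-diagonal : ∀ {m N₁ N₂ N₃} (D : SliceDecomposition m N₁ N₂ N₃) →
                         (∀ i j k → diagonal i j k ≡ SliceDecomposition.tensor D i j k mod p) →
                         m ≤ N₁ ℕ.+ N₂ ℕ.+ N₃
    sliceRank-diagonal {m} {N₁} {N₂} {N₃} D diagonal≡D with pivotedFamily (SliceDecomposition.X D)
    ... | d , m≤d+N₁ , K =
      ℕ.≤-trans m≤d+N₁ (ℕ.≤-trans (ℕ.+-monoˡ-≤ N₁ d≤N₂+N₃) (ℕ.≤-reflexive N₂+N₃+N₁≡N₁+N₂+N₃))
      where
      open SliceDecomposition D
      open PivotedFamily K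
      v = pivotSum K
      g : Fin N₂ → Vector ℤ d
      g r k = v · (λ i → G r i (pivot k))
      w : Fin N₃ → Vector ℤ d
      w r k = W r (pivot k)
      -- Contracting with v in the first slot, the pivot a = pivot j₀ in the second and u along the
      -- pivots in the third sends the diagonal to v a * u j₀ ≢ 0, but every slice to 0 (mod p).
      noKernelVector : ¬ (∃[ u ] ∃[ j ] ((∀ r → + p ∣ (g ++ w) r · u) × ¬ + p ∣ u j))
      noKernelVector (u , j₀ , u∈ker , p∤u) = p∤m⇒p∤n⇒p∤m*n (pivotSum-at-pivot K j₀) p∤u
        (subst (+ p ∣_) (contract-diagonal pivot-injective j₀ refl)
          (≡-mod-∣ (contract-cong diagonal tensor diagonal≡D)
            (∣-contract-tensor D (forms·pivotSum K)
              (λ r → subst (λ ℓ → + p ∣ ℓ · u) (lookup-++ˡ g w r) (u∈ker (r ↑ˡ N₃)))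
              (λ r → subst (λ ℓ → + p ∣ ℓ · u) (lookup-++ʳ g w r) (u∈ker (N₂ ↑ʳ r))))))
        where open Contraction v u pivot (pivot j₀)
      d≤N₂+N₃ : d ≤ N₂ ℕ.+ N₃
      d≤N₂+N₃ = ℕ.≮⇒≥ (λ N₂+N₃<d → noKernelVector (nonzeroKernelVector (g ++ w) N₂+N₃<d))
      N₂+N₃+N₁≡N₁+N₂+N₃ : N₂ ℕ.+ N₃ ℕ.+ N₁ ≡ N₁ ℕ.+ N₂ ℕ.+ N₃
      N₂+N₃+N₁≡N₁+N₂+N₃ = trans (ℕ.+-comm (N₂ ℕ.+ N₃) N₁) (sym (ℕ.+-assoc N₁ N₂ N₃))

  data SliceTag {m N₁ N₂ N₃} (X : Fin N₁ → Vector ℤ m) (Y : Fin N₂ → Vector ℤ m)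
                (W : Fin N₃ → Vector ℤ m) (x y w : Vector ℤ m) : Set where
    first  : ∀ r → (∀ i → X r i ≡ x i) → SliceTag X Y W x y w
    second : ∀ r → (∀ j → Y r j ≡ y j) → SliceTag X Y W x y w
    third  : ∀ r → (∀ k → W r k ≡ w k) → SliceTag X Y W x y w

  module SliceGrouping {a} {A : Set a} {m N₁ N₂ N₃} (terms : List A) (f g h : A → Vector ℤ m)
                       (X : Fin N₁ → Vector ℤ m) (Y : Fin N₂ → Vector ℤ m) (W : Fin N₃ → Vector ℤ m)
                       (tag : ∀ μ → SliceTag X Y W (f μ) (g μ) (h μ)) where

    select₁ : ∀ {x y w} → SliceTag X Y W x y w → Fin N₁ → ℤ
    select₁ (first r′ _) r = δ r′ r
    select₁ _            r = 0ℤ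

    select₂ : ∀ {x y w} → SliceTag X Y W x y w → Fin N₂ → ℤ
    select₂ (second r′ _) r = δ r′ r
    select₂ _             r = 0ℤ

    select₃ : ∀ {x y w} → SliceTag X Y W x y w → Fin N₃ → ℤ
    select₃ (third r′ _) r = δ r′ r
    select₃ _            r = 0ℤ

    grouped : SliceDecomposition m N₁ N₂ N₃
    grouped = record
      { X = X ; F = λ r j k → ∑[ μ ∈ terms ] (select₁ (tag μ) r * (g μ j * h μ k))
      ; Y = Y ; G = λ r i k → ∑[ μ ∈ terms ] (select₂ (tag μ) r * (f μ i * h μ k))
      ; W = W ; H = λ r i j → ∑[ μ ∈ terms ] (select₃ (tag μ) r * (f μ i * g μ j))
      }

    private
      ∑-δ-scaled : ∀ {N} (Z : Fin N → ℤ) r′ c → ∑[ r < N ] (Z r * (δ r′ r * c)) ≡ Z r′ * c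
      ∑-δ-scaled {N} Z r′ c =
        trans (sum-cong-≗ (λ r → rearrange (Z r) (δ r′ r) c)) (∑-δ r′ (λ r → Z r * c))
        where
        rearrange : ∀ z d c → z * (d * c) ≡ d * (z * c)
        rearrange = solve-∀

      ∑-zero-scaled : ∀ {N} (Z : Fin N → ℤ) → ∑[ r < N ] (Z r * 0ℤ) ≡ 0ℤ
      ∑-zero-scaled {N} Z = trans (sum-cong-≗ (λ r → ℤ.*-zeroʳ (Z r))) (sum-replicate-zero N)

      exchange : ∀ {N} (Z : Fin N → ℤ) (select : A → Fin N → ℤ) (c : A → ℤ) →
                 ∑[ r < N ] (Z r * ∑[ μ ∈ terms ] (select μ r * c μ)) ≡
                 ∑[ μ ∈ terms ] ∑[ r < N ] (Z r * (select μ r * c μ))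
      exchange {N} Z select c =
        trans (sum-cong-≗ (λ r → *-distribˡ-∑ₗ (Z r) terms _)) (∑-∑ₗ-comm {n = N} terms _)

      termwise : ∀ μ i j k →
        ∑[ r < N₁ ] (X r i * (select₁ (tag μ) r * (g μ j * h μ k))) +
        ∑[ r < N₂ ] (Y r j * (select₂ (tag μ) r * (f μ i * h μ k))) +
        ∑[ r < N₃ ] (W r k * (select₃ (tag μ) r * (f μ i * g μ j))) ≡ f μ i * g μ j * h μ k
      termwise μ i j k with tag μ
      ... | first r′ X≡f = begin
        _ ≡⟨ cong₂ _+_ (cong₂ _+_ (∑-δ-scaled (λ r → X r i) r′ _) (∑-zero-scaled (λ r → Y r j)))
                       (∑-zero-scaled (λ r → W r k)) ⟩
        X r′ i * (g μ j * h μ k) + 0ℤ + 0ℤ ≡⟨ cong (λ x → x * (g μ j * h μ k) + 0ℤ + 0ℤ) (X≡f i) ⟩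
        f μ i * (g μ j * h μ k) + 0ℤ + 0ℤ ≡⟨ normalise (f μ i) (g μ j) (h μ k) ⟩
        f μ i * g μ j * h μ k             ∎
        where
        open ≡.≡-Reasoning
        normalise : ∀ x y z → x * (y * z) + 0ℤ + 0ℤ ≡ x * y * z
        normalise = solve-∀
      ... | second r′ Y≡g = begin
        _ ≡⟨ cong₂ _+_ (cong₂ _+_ (∑-zero-scaled (λ r → X r i)) (∑-δ-scaled (λ r → Y r j) r′ _))
                       (∑-zero-scaled (λ r → W r k)) ⟩
        0ℤ + Y r′ j * (f μ i * h μ k) + 0ℤ ≡⟨ cong (λ y → 0ℤ + y * (f μ i * h μ k) + 0ℤ) (Y≡g j) ⟩
        0ℤ + g μ j * (f μ i * h μ k) + 0ℤ ≡⟨ normalise (f μ i) (g μ j) (h μ k) ⟩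
        f μ i * g μ j * h μ k             ∎
        where
        open ≡.≡-Reasoning
        normalise : ∀ x y z → 0ℤ + y * (x * z) + 0ℤ ≡ x * y * z
        normalise = solve-∀
      ... | third r′ W≡h = begin
        _ ≡⟨ cong₂ _+_ (cong₂ _+_ (∑-zero-scaled (λ r → X r i)) (∑-zero-scaled (λ r → Y r j)))
                       (∑-δ-scaled (λ r → W r k) r′ _) ⟩
        0ℤ + 0ℤ + W r′ k * (f μ i * g μ j) ≡⟨ cong (λ w → 0ℤ + 0ℤ + w * (f μ i * g μ j)) (W≡h k) ⟩
        0ℤ + 0ℤ + h μ k * (f μ i * g μ j) ≡⟨ normalise (f μ i) (g μ j) (h μ k) ⟩
        f μ i * g μ j * h μ k             ∎
        where
        open ≡.≡-Reasoning
        normalise : ∀ x y z → 0ℤ + 0ℤ + z * (x * y) ≡ x * y * z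
        normalise = solve-∀

    grouped-tensor : ∀ i j k →
                     ∑[ μ ∈ terms ] (f μ i * g μ j * h μ k) ≡ SliceDecomposition.tensor grouped i j k
    grouped-tensor i j k = sym (begin
      SliceDecomposition.tensor grouped i j k
        ≡⟨ cong₂ _+_ (cong₂ _+_ (exchange (λ r → X r i) (select₁ ∘ tag) (λ μ → g μ j * h μ k))
                                (exchange (λ r → Y r j) (select₂ ∘ tag) (λ μ → f μ i * h μ k)))
                     (exchange (λ r → W r k) (select₃ ∘ tag) (λ μ → f μ i * g μ j)) ⟩
      ∑[ μ ∈ terms ] t₁ μ + ∑[ μ ∈ terms ] t₂ μ + ∑[ μ ∈ terms ] t₃ μ
        ≡⟨ cong (_+ ∑[ μ ∈ terms ] t₃ μ) (sym (∑ₗ-distrib-+ terms t₁ t₂)) ⟩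
      ∑[ μ ∈ terms ] (t₁ μ + t₂ μ) + ∑[ μ ∈ terms ] t₃ μ
        ≡⟨ sym (∑ₗ-distrib-+ terms (λ μ → t₁ μ + t₂ μ) t₃) ⟩
      ∑[ μ ∈ terms ] (t₁ μ + t₂ μ + t₃ μ)
        ≡⟨ ∑ₗ-cong terms (λ μ → termwise μ i j k) ⟩
      ∑[ μ ∈ terms ] (f μ i * g μ j * h μ k) ∎)
      where
      open ≡.≡-Reasoning
      t₁ t₂ t₃ : A → ℤ
      t₁ μ = ∑[ r < N₁ ] (X r i * (select₁ (tag μ) r * (g μ j * h μ k)))
      t₂ μ = ∑[ r < N₂ ] (Y r j * (select₂ (tag μ) r * (f μ i * h μ k)))
      t₃ μ = ∑[ r < N₃ ] (W r k * (select₃ (tag μ) r * (f μ i * g μ j)))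

module Binomials where

  open import Data.Integer.Base using (ℤ; +_; 0ℤ; 1ℤ; _+_; _*_; _-_)
  import Data.Integer.Divisibility.Signed as ℤ∣
  import Data.Integer.Properties as ℤ
  open import Data.Integer.Tactic.RingSolver using (solve-∀)
  open import Data.List.Base using (List; []; _∷_; map; concatMap)
  open import Data.Nat.Base as ℕ using (ℕ; zero; suc; _≤_; _<_; _^_; s≤s; z≤n)
  open import Data.Nat.Combinatorics using (_C_; nCk+nC[k+1]≡[n+1]C[k+1]; nC1≡n; nCn≡1; k>n⇒nCk≡0)
  open import Data.Nat.DivMod using (_%_; _/_; m≡m%n+[m/n]*n; m%n<n)
  open import Data.Nat.Divisibility as ℕ∣ using (_∣_)
  open import Data.Nat.Primality using (Prime; euclidsLemma; prime⇒nonZero)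
  import Data.Nat.Properties as ℕ
  open import Data.Nat.Tactic.RingSolver as ℕ-Solver using ()
  open import Data.Sum using (inj₁; inj₂)
  open import Relation.Binary.PropositionalEquality as ≡
    using (_≡_; refl; sym; trans; cong; cong₂; subst; subst₂)
  open import Relation.Nullary using (¬_; yes; no; contradiction)

  open FiniteSums ℤ.+-*-commutativeSemiring
  open IntegerSums using (_≡_mod_; ∣0; ∣-∑ₗ)

  infix 8 _Cᶻ_

  _Cᶻ_ : ℕ → ℕ → ℤ
  n Cᶻ k = + (n C k)

  pascal : ∀ n k → suc n Cᶻ suc k ≡ n Cᶻ k + n Cᶻ suc k
  pascal n k = cong +_ (sym (nCk+nC[k+1]≡[n+1]C[k+1] n k))

  record Split (k : ℕ) : Set where
    constructor split
    field
      left right  : ℕ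
      left+right≡k : left ℕ.+ right ≡ k

  open Split

  shiftLeft : ∀ {k} → Split k → Split (suc k)
  shiftLeft (split i j i+j≡k) = split (suc i) j (cong suc i+j≡k)

  splits : (k : ℕ) → List (Split k)
  splits zero    = split 0 0 refl ∷ []
  splits (suc k) = split 0 (suc k) refl ∷ map shiftLeft (splits k)

  vandermonde : ∀ x y k → ∑[ s ∈ splits k ] (x Cᶻ left s * y Cᶻ right s) ≡ (x ℕ.+ y) Cᶻ k
  vandermonde zero    y zero    = refl
  vandermonde zero    y (suc k) = begin
    1ℤ * y Cᶻ suc k + ∑[ s ∈ map shiftLeft (splits k) ] (0 Cᶻ left s * y Cᶻ right s)
      ≡⟨ cong (_+_ (1ℤ * y Cᶻ suc k)) (trans (∑ₗ-map shiftLeft (splits k) _) (∑ₗ-zero (splits k))) ⟩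
    1ℤ * y Cᶻ suc k + 0ℤ
      ≡⟨ trans (ℤ.+-identityʳ _) (ℤ.*-identityˡ _) ⟩
    y Cᶻ suc k ∎
    where open ≡.≡-Reasoning
  vandermonde (suc x) y zero    = refl
  vandermonde (suc x) y (suc k) = begin
    1ℤ * y Cᶻ suc k + ∑[ s ∈ map shiftLeft (splits k) ] (suc x Cᶻ left s * y Cᶻ right s)
      ≡⟨ cong (_+_ (1ℤ * y Cᶻ suc k)) (∑ₗ-map shiftLeft (splits k) _) ⟩
    1ℤ * y Cᶻ suc k + ∑[ s ∈ splits k ] (suc x Cᶻ suc (left s) * y Cᶻ right s)
      ≡⟨ cong (_+_ (1ℤ * y Cᶻ suc k)) (trans (∑ₗ-cong (splits k) pascal-term) (∑ₗ-distrib-+ (splits k) _ _)) ⟩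
    1ℤ * y Cᶻ suc k + (S k + T)
      ≡⟨ x+[y+z]≡y+[x+z] (1ℤ * y Cᶻ suc k) (S k) T ⟩
    S k + (1ℤ * y Cᶻ suc k + T)
      ≡⟨ cong (_+_ (S k)) (sym (cong (_+_ (1ℤ * y Cᶻ suc k)) (∑ₗ-map shiftLeft (splits k) _))) ⟩
    S k + S (suc k)
      ≡⟨ cong₂ _+_ (vandermonde x y k) (vandermonde x y (suc k)) ⟩
    (x ℕ.+ y) Cᶻ k + (x ℕ.+ y) Cᶻ suc k
      ≡⟨ sym (pascal (x ℕ.+ y) k) ⟩
    (suc x ℕ.+ y) Cᶻ suc k ∎
    where
    open ≡.≡-Reasoning
    S : ∀ k → ℤ
    S k = ∑[ s ∈ splits k ] (x Cᶻ left s * y Cᶻ right s)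
    T = ∑[ s ∈ splits k ] (x Cᶻ suc (left s) * y Cᶻ right s)
    pascal-term : ∀ s → suc x Cᶻ suc (left s) * y Cᶻ right s ≡
                        x Cᶻ left s * y Cᶻ right s + x Cᶻ suc (left s) * y Cᶻ right s
    pascal-term s = trans (cong (_* y Cᶻ right s) (pascal x (left s)))
                          (ℤ.*-distribʳ-+ (y Cᶻ right s) (x Cᶻ left s) (x Cᶻ suc (left s)))
    x+[y+z]≡y+[x+z] : ∀ a b c → a + (b + c) ≡ b + (a + c)
    x+[y+z]≡y+[x+z] = solve-∀

  record Triple (L : ℕ) : Set where
    constructor triple
    field
      a b c   : ℕ
      a+b+c≡L : a ℕ.+ (b ℕ.+ c) ≡ L

  open Triple

  triples : (L : ℕ) → List (Triple L)
  triples L = concatMap (λ s → map (compose s) (splits (right s))) (splits L)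
    where
    compose : ∀ (s : Split L) → Split (right s) → Triple L
    compose s s′ = triple (left s) (left s′) (right s′) (trans (cong (left s ℕ.+_) (left+right≡k s′)) (left+right≡k s))

  module _ {L : ℕ} (τ : Triple L) where

    a≤L : a τ ≤ L
    a≤L = subst (a τ ≤_) (a+b+c≡L τ) (ℕ.m≤m+n (a τ) _)

    b≤L : b τ ≤ L
    b≤L = subst (b τ ≤_) (a+b+c≡L τ) (ℕ.≤-trans (ℕ.m≤m+n (b τ) (c τ)) (ℕ.m≤n+m _ (a τ)))

    c≤L : c τ ≤ L
    c≤L = subst (c τ ≤_) (a+b+c≡L τ) (ℕ.≤-trans (ℕ.m≤n+m (c τ) (b τ)) (ℕ.m≤n+m _ (a τ)))

  trinomial : ∀ x y z L → ∑[ t ∈ triples L ] (x Cᶻ a t * y Cᶻ b t * z Cᶻ c t) ≡ (x ℕ.+ (y ℕ.+ z)) Cᶻ L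
  trinomial x y z L = begin
    ∑[ t ∈ triples L ] (x Cᶻ a t * y Cᶻ b t * z Cᶻ c t)
      ≡⟨ ∑ₗ-concatMap _ (splits L) _ ⟩
    ∑[ s ∈ splits L ] ∑[ t ∈ map _ (splits (right s)) ] (x Cᶻ a t * y Cᶻ b t * z Cᶻ c t)
      ≡⟨ ∑ₗ-cong (splits L) (λ s → trans (∑ₗ-map _ (splits (right s)) _) (inner s)) ⟩
    ∑[ s ∈ splits L ] (x Cᶻ left s * (y ℕ.+ z) Cᶻ right s)
      ≡⟨ vandermonde x (y ℕ.+ z) L ⟩
    (x ℕ.+ (y ℕ.+ z)) Cᶻ L ∎
    where
    open ≡.≡-Reasoning
    inner : ∀ s → ∑[ s′ ∈ splits (right s) ] (x Cᶻ left s * y Cᶻ left s′ * z Cᶻ right s′) ≡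
                  x Cᶻ left s * (y ℕ.+ z) Cᶻ right s
    inner s = trans (∑ₗ-cong (splits (right s)) (λ s′ → ℤ.*-assoc (x Cᶻ left s) _ _))
                (trans (sym (*-distribˡ-∑ₗ (x Cᶻ left s) (splits (right s)) _))
                       (cong (x Cᶻ left s *_) (vandermonde y z (right s))))

  absorption : ∀ N i → suc i ℕ.* (suc N C suc i) ≡ suc N ℕ.* (N C i)
  absorption zero    zero    = refl
  absorption zero    (suc i) =
    trans (cong (suc (suc i) ℕ.*_) (k>n⇒nCk≡0 {1} (s≤s (s≤s (z≤n {i}))))) (ℕ.*-zeroʳ (suc (suc i)))
  absorption (suc N) zero    =
    trans (ℕ.+-identityʳ (suc (suc N) C 1)) (trans (nC1≡n (suc (suc N))) (sym (ℕ.*-identityʳ (suc (suc N)))))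
  absorption (suc N) (suc i) = begin
    suc (suc i) ℕ.* (suc (suc N) C suc (suc i))
      ≡⟨ cong (suc (suc i) ℕ.*_) (sym (nCk+nC[k+1]≡[n+1]C[k+1] (suc N) (suc i))) ⟩
    suc (suc i) ℕ.* (suc N C suc i ℕ.+ suc N C suc (suc i))
      ≡⟨ expand i (suc N C suc i) (suc N C suc (suc i)) ⟩
    suc N C suc i ℕ.+ suc i ℕ.* (suc N C suc i) ℕ.+ suc (suc i) ℕ.* (suc N C suc (suc i))
      ≡⟨ cong₂ (λ u v → suc N C suc i ℕ.+ u ℕ.+ v) (absorption N i) (absorption N (suc i)) ⟩
    suc N C suc i ℕ.+ suc N ℕ.* (N C i) ℕ.+ suc N ℕ.* (N C suc i)
      ≡⟨ collect N (suc N C suc i) (N C i) (N C suc i) ⟩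
    suc N C suc i ℕ.+ suc N ℕ.* (N C i ℕ.+ N C suc i)
      ≡⟨ cong (λ u → suc N C suc i ℕ.+ suc N ℕ.* u) (nCk+nC[k+1]≡[n+1]C[k+1] N i) ⟩
    suc (suc N) ℕ.* (suc N C suc i) ∎
    where
    open ≡.≡-Reasoning
    expand : ∀ i u v → suc (suc i) ℕ.* (u ℕ.+ v) ≡ u ℕ.+ suc i ℕ.* u ℕ.+ suc (suc i) ℕ.* v
    expand = ℕ-Solver.solve-∀
    collect : ∀ N c u v → c ℕ.+ suc N ℕ.* u ℕ.+ suc N ℕ.* v ≡ c ℕ.+ suc N ℕ.* (u ℕ.+ v)
    collect = ℕ-Solver.solve-∀

  zeroIndicator : ℕ → ℤ
  zeroIndicator zero    = 1ℤ
  zeroIndicator (suc _) = 0ℤ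

  module _ {p : ℕ} (p-prime : Prime p) where

    p^e∣m*n⇒p^e∣m : ∀ e {m n} → ¬ p ∣ n → p ^ e ∣ m ℕ.* n → p ^ e ∣ m
    p^e∣m*n⇒p^e∣m zero    {m}     p∤n _ = ℕ∣.1∣ m
    p^e∣m*n⇒p^e∣m (suc e) {m} {n} p∤n p^[1+e]∣mn
      with euclidsLemma m n p-prime (ℕ∣.∣-trans (ℕ∣.m∣m*n (p ^ e)) p^[1+e]∣mn)
    ... | inj₂ p∣n = contradiction p∣n p∤n
    ... | inj₁ (ℕ∣.divides m′ refl) = subst (p ^ suc e ∣_) (ℕ.*-comm p m′) (ℕ∣.*-monoʳ-∣ p p^e∣m′)
      where
      instance _ = prime⇒nonZero p-prime
      reassoc : ∀ m′ p n → m′ ℕ.* p ℕ.* n ≡ p ℕ.* (m′ ℕ.* n)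
      reassoc = ℕ-Solver.solve-∀
      p^e∣m′ : p ^ e ∣ m′
      p^e∣m′ = p^e∣m*n⇒p^e∣m e p∤n (ℕ∣.*-cancelˡ-∣ p (subst (p ℕ.* p ^ e ∣_) (reassoc m′ p n) p^[1+e]∣mn))

    module _ {q e} (q≡p^[1+e] : q ≡ p ^ suc e) where

      -- If p ∤ (tq choose i+1), then q ∣ i + 1 by the absorption identity.
      p∣[t*q]C[1+i] : ∀ t i → suc i < q → p ∣ (t ℕ.* q) C suc i
      p∣[t*q]C[1+i] t i 1+i<q with t ℕ.* q in tq≡
      ... | zero  = p ℕ∣.∣0
      ... | suc N with p ℕ∣.∣? suc N C suc i
      ...   | yes p∣C = p∣C
      ...   | no  p∤C = contradiction (ℕ∣.∣⇒≤ q∣1+i) (ℕ.<⇒≱ 1+i<q)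
        where
        q∣1+N : q ∣ suc N
        q∣1+N = subst (q ∣_) tq≡ (ℕ∣.n∣m*n t)
        q∣[1+i]*C : q ∣ suc i ℕ.* (suc N C suc i)
        q∣[1+i]*C = subst (q ∣_) (sym (absorption N i)) (ℕ∣.∣-trans q∣1+N (ℕ∣.m∣m*n (N C i)))
        q∣1+i : q ∣ suc i
        q∣1+i = subst (_∣ suc i) (sym q≡p^[1+e])
                  (p^e∣m*n⇒p^e∣m (suc e) p∤C (subst (_∣ suc i ℕ.* (suc N C suc i)) q≡p^[1+e] q∣[1+i]*C))

      binomial-periodic : ∀ t r L → L < q → (t ℕ.* q ℕ.+ r) Cᶻ L ≡ r Cᶻ L mod p
      binomial-periodic t r zero     _   = ∣0
      binomial-periodic t r (suc L′) L<q = subst (ℤ∣._∣_ (+ p)) (sym difference) (∣-∑ₗ (splits L′) p∣term)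
        where
        left<q : ∀ (s : Split L′) → suc (left s) < q
        left<q s = ℕ.≤-<-trans (s≤s (ℕ.m≤m+n (left s) (right s))) (subst (λ k → suc k < q) (sym (left+right≡k s)) L<q)
        p∣term : ∀ s → + p ℤ∣.∣ (t ℕ.* q) Cᶻ suc (left s) * r Cᶻ right s
        p∣term s = ℤ∣.∣m⇒∣m*n (r Cᶻ right s)
                     (ℤ∣.∣ᵤ⇒∣ {i = (t ℕ.* q) Cᶻ suc (left s)} (p∣[t*q]C[1+i] t (left s) (left<q s)))
        difference : (t ℕ.* q ℕ.+ r) Cᶻ suc L′ - r Cᶻ suc L′ ≡
                     ∑[ s ∈ splits L′ ] ((t ℕ.* q) Cᶻ suc (left s) * r Cᶻ right s)
        difference = begin
          (t ℕ.* q ℕ.+ r) Cᶻ suc L′ - r Cᶻ suc L′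
            ≡⟨ cong (_- r Cᶻ suc L′) (sym (vandermonde (t ℕ.* q) r (suc L′))) ⟩
          1ℤ * r Cᶻ suc L′ + ∑[ s ∈ map shiftLeft (splits L′) ] ((t ℕ.* q) Cᶻ left s * r Cᶻ right s) - r Cᶻ suc L′
            ≡⟨ cancel (r Cᶻ suc L′) _ ⟩
          ∑[ s ∈ map shiftLeft (splits L′) ] ((t ℕ.* q) Cᶻ left s * r Cᶻ right s)
            ≡⟨ ∑ₗ-map shiftLeft (splits L′) _ ⟩
          ∑[ s ∈ splits L′ ] ((t ℕ.* q) Cᶻ suc (left s) * r Cᶻ right s) ∎
          where
          open ≡.≡-Reasoning
          cancel : ∀ x y → 1ℤ * x + y - x ≡ y
          cancel = solve-∀

    binomial-indicator : ∀ e L → suc L ≡ p ^ suc e → ∀ w → (w ℕ.+ L) Cᶻ L ≡ zeroIndicator (w % suc L) mod p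
    binomial-indicator e L q≡p^[1+e] w =
      byRemainder (w % suc L) (w / suc L) (m≡m%n+[m/n]*n w (suc L)) (m%n<n w (suc L))
      where
      byRemainder : ∀ r t → w ≡ r ℕ.+ t ℕ.* suc L → r < suc L → (w ℕ.+ L) Cᶻ L ≡ zeroIndicator r mod p
      byRemainder zero    t refl _         = subst₂ (λ x y → x Cᶻ L ≡ + y mod p) refl (nCn≡1 L)
        (binomial-periodic {e = e} q≡p^[1+e] t L L (ℕ.n<1+n L))
      byRemainder (suc r) t refl (s≤s r<L) = subst₂ (λ x y → x Cᶻ L ≡ + y mod p) (regroup r t L) (k>n⇒nCk≡0 r<L)
        (binomial-periodic {e = e} q≡p^[1+e] (suc t) r L (ℕ.n<1+n L))
        where
        regroup : ∀ r t L → suc t ℕ.* suc L ℕ.+ r ≡ suc r ℕ.+ t ℕ.* suc L ℕ.+ L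
        regroup = ℕ-Solver.solve-∀

module ExponentCounting where

  open import Data.Fin.Base using (Fin; zero; suc; toℕ)
  open import Data.Fin.Properties using (toℕ<n)
  open import Data.List.Base as List using (List; []; _∷_; length; filter; upTo)
  open import Data.List.Extrema.Nat using (argmin; argmin-all; f[argmin]≤f[⊤]; f[argmin]≤f[xs])
  open import Data.List.Properties using (map-applyUpTo)
  open import Data.List.Relation.Unary.All as All using (All; []; _∷_)
  open import Data.List.Relation.Unary.All.Properties using (all-filter)
  open import Data.Nat.Base using (ℕ; zero; suc; _+_; _*_; _^_; _∸_; _≤_; _<_; z≤n; s≤s; NonZero; >-nonZero)
  open import Data.Nat.Properties
  open import Data.Nat.Tactic.RingSolver using (solve-∀)
  open import Data.Product using (_,_)
  open import Data.Sum using (inj₁; inj₂)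
  open import Data.Vec.Base as Vec using (Vec; []; _∷_; lookup)
  open import Function.Base using (_∘_)
  open import Relation.Binary.PropositionalEquality as ≡ using (_≡_; refl; sym; trans; cong; cong₂; subst; subst₂)
  open import Relation.Nullary using (Dec; yes; no)
  open import Relation.Unary using (Pred)

  open AllVectors using (allVectors)
  open FiniteSums +-*-commutativeSemiring

  ^-distribʳ-* : ∀ m n k → (m * n) ^ k ≡ m ^ k * n ^ k
  ^-distribʳ-* m n zero    = refl
  ^-distribʳ-* m n (suc k) = trans (cong (m * n *_) (^-distribʳ-* m n k)) (interchange m n (m ^ k) (n ^ k))
    where
    interchange : ∀ a b c d → a * b * (c * d) ≡ a * c * (b * d)
    interchange = solve-∀

  m≤m∸n+n : ∀ m n → m ≤ m ∸ n + n
  m≤m∸n+n m n with ≤-total n m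
  ... | inj₁ n≤m = ≤-reflexive (sym (m∸n+n≡m n≤m))
  ... | inj₂ m≤n = subst (m ≤_) (cong (_+ n) (sym (m≤n⇒m∸n≡0 m≤n))) m≤n

  exchangePowers : ∀ {a b} s t → b ≤ a → s ≤ t → b ^ t * a ^ s ≤ a ^ t * b ^ s
  exchangePowers {a} {b} s t b≤a s≤t with d , refl ← m≤n⇒∃[o]m+o≡n s≤t = begin
    b ^ (s + d) * a ^ s     ≡⟨ cong (_* a ^ s) (^-distribˡ-+-* b s d) ⟩
    b ^ s * b ^ d * a ^ s   ≤⟨ *-monoˡ-≤ (a ^ s) (*-monoʳ-≤ (b ^ s) (^-monoˡ-≤ d b≤a)) ⟩
    b ^ s * a ^ d * a ^ s   ≡⟨ rearrange (b ^ s) (a ^ d) (a ^ s) ⟩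
    a ^ s * a ^ d * b ^ s   ≡⟨ cong (_* b ^ s) (sym (^-distribˡ-+-* a s d)) ⟩
    a ^ (s + d) * b ^ s     ∎
    where
    open ≤-Reasoning
    rearrange : ∀ x y z → x * y * z ≡ z * y * x
    rearrange = solve-∀

  module _ {a} {A : Set a} where

    ∑ₗ-filter-≤ : ∀ {p} {P : Pred A p} (P? : ∀ x → Dec (P x)) xs (f : A → ℕ) →
                  ∑[ x ∈ filter P? xs ] f x ≤ ∑[ x ∈ xs ] f x
    ∑ₗ-filter-≤ P? []       f = ≤-refl
    ∑ₗ-filter-≤ P? (x ∷ xs) f with P? x
    ... | yes _ = +-monoʳ-≤ (f x) (∑ₗ-filter-≤ P? xs f)
    ... | no  _ = ≤-trans (∑ₗ-filter-≤ P? xs f) (m≤n+m _ (f x))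

    length*≤∑ₗ : ∀ c (xs : List A) (f : A → ℕ) → All (λ x → c ≤ f x) xs →
                 length xs * c ≤ ∑[ x ∈ xs ] f x
    length*≤∑ₗ c []       f []           = ≤-refl
    length*≤∑ₗ c (x ∷ xs) f (c≤fx ∷ c≤f) = +-mono-≤ c≤fx (length*≤∑ₗ c xs f c≤f)

    length^*≤∑ₗ^ : ∀ k .{{_ : NonZero k}} K (xs : List A) (f : A → ℕ) →
                   All (λ x → K ≤ f x ^ k) xs → length xs ^ k * K ≤ (∑[ x ∈ xs ] f x) ^ k
    length^*≤∑ₗ^ (suc k) K []       f []                 = z≤n
    length^*≤∑ₗ^ k       K (y ∷ ys) f (K≤fy^k ∷ K≤f^k) = begin
      length (y ∷ ys) ^ k * K        ≤⟨ *-monoʳ-≤ (length (y ∷ ys) ^ k) K≤fx₀^k ⟩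
      length (y ∷ ys) ^ k * f x₀ ^ k ≡⟨ sym (^-distribʳ-* (length (y ∷ ys)) (f x₀) k) ⟩
      (length (y ∷ ys) * f x₀) ^ k   ≤⟨ ^-monoˡ-≤ k (length*≤∑ₗ (f x₀) (y ∷ ys) f fx₀≤f) ⟩
      (∑[ x ∈ y ∷ ys ] f x) ^ k      ∎
      where
      open ≤-Reasoning
      x₀ = argmin f y ys
      K≤fx₀^k : K ≤ f x₀ ^ k
      K≤fx₀^k = argmin-all f {P = λ x → K ≤ f x ^ k} K≤fy^k K≤f^k
      fx₀≤f : All (λ x → f x₀ ≤ f x) (y ∷ ys)
      fx₀≤f = f[argmin]≤f[⊤] {f = f} y ys ∷ f[argmin]≤f[xs] {f = f} y ys

  ∏-const : ∀ n c → ∏[ i < n ] c ≡ c ^ n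
  ∏-const zero    c = refl
  ∏-const (suc n) c = cong (c *_) (∏-const n c)

  ∏-mono-≤ : ∀ {n} {f g : Fin n → ℕ} → (∀ i → f i ≤ g i) → ∏[ i < n ] f i ≤ ∏[ i < n ] g i
  ∏-mono-≤ {zero}  f≤g = ≤-refl
  ∏-mono-≤ {suc n} f≤g = *-mono-≤ (f≤g zero) (∏-mono-≤ (f≤g ∘ suc))

  ∏-nonZero : ∀ {n} (f : Fin n → ℕ) → (∀ i → NonZero (f i)) → NonZero (∏[ i < n ] f i)
  ∏-nonZero {zero}  f f≢0 = _
  ∏-nonZero {suc n} f f≢0 = m*n≢0 (f zero) _ {{f≢0 zero}} {{∏-nonZero (f ∘ suc) (f≢0 ∘ suc)}}

  telescope : ∀ k (g : ℕ → ℕ) → ∏[ i < k ] g (suc (toℕ i)) * g 0 ≡ ∏[ i < k ] g (toℕ i) * g k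
  telescope zero    g = refl
  telescope (suc k) g = begin
    g 1 * ∏[ i < k ] g (suc (suc (toℕ i))) * g 0   ≡⟨ rotate (g 1) _ (g 0) ⟩
    g 0 * (∏[ i < k ] g (suc (suc (toℕ i))) * g 1) ≡⟨ cong (g 0 *_) (telescope k (g ∘ suc)) ⟩
    g 0 * (∏[ i < k ] g (suc (toℕ i)) * g (suc k)) ≡⟨ sym (*-assoc (g 0) _ _) ⟩
    g 0 * ∏[ i < k ] g (suc (toℕ i)) * g (suc k)   ∎
    where
    open ≡.≡-Reasoning
    rotate : ∀ x y z → x * y * z ≡ z * (y * x)
    rotate = solve-∀

  -- The two factors differ by (a - b)² (a + b + 1).
  pairInequality : ∀ a b → (a + b + 2) * (a + b + 2) * (a * b) ≤ (a + 1) * (b + 1) * ((a + b) * (a + b))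
  pairInequality a b with ≤-total a b
  ... | inj₁ a≤b with d , refl ← m≤n⇒∃[o]m+o≡n a≤b = ≤-trans (m≤m+n _ _) (≤-reflexive (sym (excess a d)))
    where
    excess : ∀ a d → (a + 1) * (a + d + 1) * ((a + (a + d)) * (a + (a + d))) ≡
                     (a + (a + d) + 2) * (a + (a + d) + 2) * (a * (a + d)) + (a + (a + d) + 1) * (d * d)
    excess = solve-∀
  ... | inj₂ b≤a with d , refl ← m≤n⇒∃[o]m+o≡n b≤a = ≤-trans (m≤m+n _ _) (≤-reflexive (sym (excess b d)))
    where
    excess : ∀ b d → (b + d + 1) * (b + 1) * ((b + d + b) * (b + d + b)) ≡
                     (b + d + b + 2) * (b + d + b + 2) * ((b + d) * b) + (b + d + b + 1) * (d * d)
    excess = solve-∀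

  ∏-pairInequality : ∀ {L} B (a b : Fin L → ℕ) → (∀ i → a i + b i ≡ B) →
                     ((B + 2) * (B + 2)) ^ L * (∏[ i < L ] a i * ∏[ i < L ] b i) ≤
                     ∏[ i < L ] (a i + 1) * ∏[ i < L ] (b i + 1) * (B * B) ^ L
  ∏-pairInequality {L} B a b a+b≡B = begin
    ((B + 2) * (B + 2)) ^ L * (∏[ i < L ] a i * ∏[ i < L ] b i)
      ≡⟨ cong₂ _*_ (sym (∏-const L ((B + 2) * (B + 2)))) (sym (∏-distrib-* {L} a b)) ⟩
    ∏[ i < L ] ((B + 2) * (B + 2)) * ∏[ i < L ] (a i * b i)
      ≡⟨ sym (∏-distrib-* {L} (λ _ → (B + 2) * (B + 2)) (λ i → a i * b i)) ⟩
    ∏[ i < L ] ((B + 2) * (B + 2) * (a i * b i))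
      ≤⟨ ∏-mono-≤ pairwise ⟩
    ∏[ i < L ] ((a i + 1) * (b i + 1) * (B * B))
      ≡⟨ ∏-distrib-* {L} (λ i → (a i + 1) * (b i + 1)) (λ _ → B * B) ⟩
    ∏[ i < L ] ((a i + 1) * (b i + 1)) * ∏[ i < L ] (B * B)
      ≡⟨ cong₂ _*_ (∏-distrib-* {L} (λ i → a i + 1) (λ i → b i + 1)) (∏-const L (B * B)) ⟩
    ∏[ i < L ] (a i + 1) * ∏[ i < L ] (b i + 1) * (B * B) ^ L ∎
    where
    open ≤-Reasoning
    pairwise : ∀ i → (B + 2) * (B + 2) * (a i * b i) ≤ (a i + 1) * (b i + 1) * (B * B)
    pairwise i = subst (λ s → (s + 2) * (s + 2) * (a i * b i) ≤ (a i + 1) * (b i + 1) * (s * s))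
                       (a+b≡B i) (pairInequality (a i) (b i))

  +-suc-end : ∀ l x → l + x + 1 ≡ l + suc x
  +-suc-end l x = trans (+-assoc l x 1) (cong (l +_) (+-comm x 1))

  ∏-ascending : ∀ L′ → ∏[ i < suc L′ ] (suc L′ + toℕ i + 1) ≡ 2 * ∏[ i < suc L′ ] (suc L′ + toℕ i)
  ∏-ascending L′ = *-cancelʳ-≡ _ _ L (begin
    ∏[ i < L ] (L + toℕ i + 1) * L         ≡⟨ cong₂ _*_ (∏-cong {L} (λ i → +-suc-end L (toℕ i))) (sym (+-identityʳ L)) ⟩
    ∏[ i < L ] (L + suc (toℕ i)) * (L + 0) ≡⟨ telescope L (L +_) ⟩
    Q * (L + L)                            ≡⟨ double Q L ⟩
    2 * Q * L                              ∎)
    where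
    open ≡.≡-Reasoning
    L = suc L′
    Q = ∏[ i < L ] (L + toℕ i)
    double : ∀ q l → q * (l + l) ≡ 2 * q * l
    double = solve-∀

  ∏-descending : ∀ L′ → ∏[ i < suc L′ ] (suc L′ + (L′ ∸ toℕ i) + 1) ≡
                        2 * ∏[ i < suc L′ ] (suc L′ + (L′ ∸ toℕ i))
  ∏-descending L′ = *-cancelʳ-≡ _ _ L (begin
    ∏[ i < L ] (L + (L′ ∸ toℕ i) + 1) * L        ≡⟨ cong₂ _*_ (∏-cong {L} (λ i → sym (L+[L∸i]≡ i))) L≡L+[L∸L] ⟩
    ∏[ i < L ] (L + (L ∸ toℕ i)) * (L + (L ∸ L)) ≡⟨ sym (telescope L (λ j → L + (L ∸ j))) ⟩
    Q * (L + L)                                  ≡⟨ double Q L ⟩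
    2 * Q * L                                    ∎)
    where
    open ≡.≡-Reasoning
    L = suc L′
    Q = ∏[ i < L ] (L + (L′ ∸ toℕ i))
    double : ∀ q l → q * (l + l) ≡ 2 * q * l
    double = solve-∀
    L+[L∸i]≡ : ∀ (i : Fin L) → L + (L ∸ toℕ i) ≡ L + (L′ ∸ toℕ i) + 1
    L+[L∸i]≡ i = trans (cong (L +_) (+-∸-assoc 1 (≤-pred (toℕ<n i)))) (sym (+-suc-end L (L′ ∸ toℕ i)))
    L≡L+[L∸L] : L ≡ L + (L ∸ L)
    L≡L+[L∸L] = trans (sym (+-identityʳ L)) (cong (L +_) (sym (n∸n≡0 L)))

  -- Writing A = 3L + 1 and B = 3L - 1, this is A^L ≤ 2 B^L. With aᵢ = L + i and bᵢ = 2L - 1 - i (i < L),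
  -- both ∏ (1 + 1/aᵢ) and ∏ (1 + 1/bᵢ) telescope to 2, while aᵢ + bᵢ = B gives
  -- (1 + 1/aᵢ)(1 + 1/bᵢ) ≥ (A/B)², so (A/B)^(2L) ≤ 4.
  keyInequality : ∀ L′ → (3 * L′ + 4) ^ suc L′ ≤ 2 * (3 * L′ + 2) ^ suc L′
  keyInequality L′ = ≮⇒≥ (λ 2B^L<A^L → <⇒≱ (*-mono-< 2B^L<A^L 2B^L<A^L) squares)
    where
    L = suc L′
    B = 3 * L′ + 2
    a b : Fin L → ℕ
    a i = L + toℕ i
    b i = L + (L′ ∸ toℕ i)
    a+b≡B : ∀ i → a i + b i ≡ B
    a+b≡B i = trans (regroup L (toℕ i) (L′ ∸ toℕ i))
                    (trans (cong ((L + L) +_) (m+[n∸m]≡n (≤-pred (toℕ<n i)))) (total L′))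
      where
      regroup : ∀ l x y → l + x + (l + y) ≡ l + l + (x + y)
      regroup = solve-∀
      total : ∀ l → suc l + suc l + l ≡ 3 * l + 2
      total = solve-∀
    Qa Qb : ℕ
    Qa = ∏[ i < L ] a i
    Qb = ∏[ i < L ] b i
    instance
      Qa*Qb≢0 : NonZero (Qa * Qb)
      Qa*Qb≢0 = m*n≢0 Qa Qb {{∏-nonZero a (λ _ → _)}} {{∏-nonZero b (λ _ → _)}}
    products : ((B + 2) * (B + 2)) ^ L * (Qa * Qb) ≤ 4 * (B * B) ^ L * (Qa * Qb)
    products = ≤-trans (∏-pairInequality B a b a+b≡B) (≤-reflexive
      (trans (cong (_* (B * B) ^ L) (cong₂ _*_ (∏-ascending L′) (∏-descending L′))) (regroup Qa Qb ((B * B) ^ L))))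
      where
      regroup : ∀ x y z → 2 * x * (2 * y) * z ≡ 4 * z * (x * y)
      regroup = solve-∀
    squares : (3 * L′ + 4) ^ L * (3 * L′ + 4) ^ L ≤ 2 * B ^ L * (2 * B ^ L)
    squares = subst₂ _≤_ (trans (^-distribʳ-* (B + 2) (B + 2) L) (cong (λ x → x ^ L * x ^ L) (+-assoc (3 * L′) 2 2)))
                         (trans (cong (4 *_) (^-distribʳ-* B B L)) (four (B ^ L)))
                         (*-cancelʳ-≤ _ _ (Qa * Qb) products)
      where
      four : ∀ y → 4 * (y * y) ≡ 2 * y * (2 * y)
      four = solve-∀

  geometricSum : ∀ B d l → d * ∑[ j ∈ upTo (suc l) ] ((B + d) ^ (l ∸ j) * B ^ j) + B ^ suc l ≡ (B + d) ^ suc l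
  geometricSum B d zero    = base B d
    where
    base : ∀ B d → d * (1 * 1 + 0) + B * 1 ≡ (B + d) * 1
    base = solve-∀
  geometricSum B d (suc l) = begin
    d * (A ^ suc l * 1 + ∑[ j ∈ List.applyUpTo suc (suc l) ] (A ^ (suc l ∸ j) * B ^ j)) + B * B ^ suc l
      ≡⟨ cong (λ x → d * (A ^ suc l * 1 + x) + B * B ^ suc l) shifted ⟩
    d * (A ^ suc l * 1 + B * S) + B * B ^ suc l
      ≡⟨ regroup d (A ^ suc l) B S (B ^ suc l) ⟩
    d * A ^ suc l + B * (d * S + B ^ suc l)
      ≡⟨ cong (λ x → d * A ^ suc l + B * x) (geometricSum B d l) ⟩
    d * A ^ suc l + B * A ^ suc l
      ≡⟨ sym (trans (*-distribʳ-+ (A ^ suc l) B d) (+-comm (B * A ^ suc l) _)) ⟩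
    A * A ^ suc l ∎
    where
    open ≡.≡-Reasoning
    A = B + d
    S = ∑[ j ∈ upTo (suc l) ] (A ^ (l ∸ j) * B ^ j)
    shifted : ∑[ j ∈ List.applyUpTo suc (suc l) ] (A ^ (suc l ∸ j) * B ^ j) ≡ B * S
    shifted = begin
      ∑[ j ∈ List.applyUpTo suc (suc l) ] (A ^ (suc l ∸ j) * B ^ j)
        ≡⟨ cong (λ js → ∑[ j ∈ js ] (A ^ (suc l ∸ j) * B ^ j)) (sym (map-applyUpTo (λ j → j) suc (suc l))) ⟩
      ∑[ j ∈ List.map suc (upTo (suc l)) ] (A ^ (suc l ∸ j) * B ^ j)
        ≡⟨ ∑ₗ-map suc (upTo (suc l)) _ ⟩
      ∑[ j ∈ upTo (suc l) ] (A ^ (l ∸ j) * (B * B ^ j))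
        ≡⟨ ∑ₗ-cong (upTo (suc l)) (λ j → x*[y*z]≡y*[x*z] (A ^ (l ∸ j)) B (B ^ j)) ⟩
      ∑[ j ∈ upTo (suc l) ] (B * (A ^ (l ∸ j) * B ^ j))
        ≡⟨ sym (*-distribˡ-∑ₗ B (upTo (suc l)) _) ⟩
      B * S ∎
      where
      x*[y*z]≡y*[x*z] : ∀ x y z → x * (y * z) ≡ y * (x * z)
      x*[y*z]≡y*[x*z] = solve-∀
    regroup : ∀ d x b s y → d * (x * 1 + b * s) + b * y ≡ d * x + b * (d * s + y)
    regroup = solve-∀

  IsLow : ∀ {n} → ℕ → Vec ℕ n → Set
  IsLow {n} L a = 3 * Vec.sum a ≤ n * L

  isLow? : ∀ {n} L (a : Vec ℕ n) → Dec (IsLow L a)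
  isLow? {n} L a = 3 * Vec.sum a ≤? n * L

  lowDegreeExponents : (n L : ℕ) → List (Vec ℕ n)
  lowDegreeExponents n L = filter (isLow? L) (allVectors (upTo (suc L)) n)

  module LowDegreeCount (L′ n : ℕ) where

    L q B A : ℕ
    L = suc L′
    q = suc L
    B = 3 * L′ + 2
    A = B + 2

    instance
      A≢0 : NonZero A
      A≢0 = >-nonZero (≤-trans (s≤s z≤n) (m≤n+m 2 B))
      B≢0 : NonZero B
      B≢0 = >-nonZero (≤-trans (s≤s z≤n) (m≤n+m 2 (3 * L′)))

    B≤A : B ≤ A
    B≤A = m≤m+n B 2

    φ : ℕ → ℕ
    φ j = A ^ (L ∸ j) * B ^ j

    G : ℕ
    G = ∑[ j ∈ upTo q ] φ j

    weight : ∀ {k} → Vec ℕ k → ℕ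
    weight {k} a = ∏[ r < k ] φ (lookup a r)

    A^L≤2B^L : A ^ L ≤ 2 * B ^ L
    A^L≤2B^L = subst (λ x → x ^ L ≤ 2 * B ^ L) (sym (+-assoc (3 * L′) 2 2)) (keyInequality L′)

    4G≤3qA^L : 4 * G ≤ 3 * q * A ^ L
    4G≤3qA^L = +-cancelʳ-≤ (B * A ^ L) (4 * G) (3 * q * A ^ L) (begin
      4 * G + B * A ^ L             ≤⟨ +-monoʳ-≤ (4 * G) (*-monoʳ-≤ B A^L≤2B^L) ⟩
      4 * G + B * (2 * B ^ L)       ≡⟨ twice G B (B ^ L) ⟩
      2 * (2 * G + B * B ^ L)       ≡⟨ cong (2 *_) (geometricSum B 2 L) ⟩
      2 * (A * A ^ L)               ≡⟨ split L′ (A ^ L) ⟩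
      3 * q * A ^ L + B * A ^ L     ∎)
      where
      open ≤-Reasoning
      twice : ∀ g x y → 4 * g + x * (2 * y) ≡ 2 * (2 * g + x * y)
      twice = solve-∀
      split : ∀ l x → 2 * ((3 * l + 2 + 2) * x) ≡ 3 * suc (suc l) * x + (3 * l + 2) * x
      split = solve-∀

    -- A low-degree exponent vector has weight at least A^(2nL/3) B^(nL/3), whose cube is cⁿ.
    c : ℕ
    c = A ^ L * A ^ L * B ^ L

    instance
      c^n≢0 : NonZero (c ^ n)
      c^n≢0 = m^n≢0 c n {{m*n≢0 _ _ {{m*n≢0 _ _ {{m^n≢0 A L}} {{m^n≢0 A L}}}} {{m^n≢0 B L}}}}

    32G³≤27q³c : 32 * G ^ 3 ≤ 27 * (q ^ 3 * c)
    32G³≤27q³c = *-cancelˡ-≤ 64 (begin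
      64 * (32 * G ^ 3)                             ≡⟨ cube-4 G ⟩
      32 * (4 * G) ^ 3                              ≤⟨ *-monoʳ-≤ 32 (^-monoˡ-≤ 3 4G≤3qA^L) ⟩
      32 * (3 * q * A ^ L) ^ 3                      ≡⟨ cube-3 q (A ^ L) ⟩
      27 * (q ^ 3 * (A ^ L * A ^ L)) * (32 * A ^ L)
                                                    ≤⟨ *-monoʳ-≤ (27 * (q ^ 3 * (A ^ L * A ^ L))) (*-monoʳ-≤ 32 A^L≤2B^L) ⟩
      27 * (q ^ 3 * (A ^ L * A ^ L)) * (32 * (2 * B ^ L)) ≡⟨ collect q (A ^ L) (B ^ L) ⟩
      64 * (27 * (q ^ 3 * c))                       ∎)
      where
      open ≤-Reasoning
      cube-4 : ∀ g → 64 * (32 * (g * (g * (g * 1)))) ≡ 32 * ((4 * g) * ((4 * g) * ((4 * g) * 1)))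
      cube-4 = solve-∀
      cube-3 : ∀ q x → 32 * ((3 * q * x) * ((3 * q * x) * ((3 * q * x) * 1))) ≡
                       27 * ((q * (q * (q * 1))) * (x * x)) * (32 * x)
      cube-3 = solve-∀
      collect : ∀ q x y → 27 * ((q * (q * (q * 1))) * (x * x)) * (32 * (2 * y)) ≡
                          64 * (27 * ((q * (q * (q * 1))) * (x * x * y)))
      collect = solve-∀

    coordinate-bound : ∀ j → A ^ L * B ^ j ≤ φ j * A ^ j
    coordinate-bound j = begin
      A ^ L * B ^ j                ≤⟨ *-monoˡ-≤ (B ^ j) (^-monoʳ-≤ A (m≤m∸n+n L j)) ⟩
      A ^ (L ∸ j + j) * B ^ j      ≡⟨ cong (_* B ^ j) (^-distribˡ-+-* A (L ∸ j) j) ⟩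
      A ^ (L ∸ j) * A ^ j * B ^ j  ≡⟨ x*y*z≡x*z*y (A ^ (L ∸ j)) (A ^ j) (B ^ j) ⟩
      φ j * A ^ j                  ∎
      where
      open ≤-Reasoning
      x*y*z≡x*z*y : ∀ x y z → x * y * z ≡ x * z * y
      x*y*z≡x*z*y = solve-∀

    -- An equality when every aᵣ ≤ L; in general L ∸ aᵣ truncates and only ≤ holds.
    weight-bound : ∀ {k} (a : Vec ℕ k) → A ^ (k * L) * B ^ Vec.sum a ≤ weight a * A ^ Vec.sum a
    weight-bound []              = ≤-refl
    weight-bound {suc k} (x ∷ a) = begin
      A ^ (L + k * L) * B ^ (x + S)   ≡⟨ cong₂ _*_ (^-distribˡ-+-* A L (k * L)) (^-distribˡ-+-* B x S) ⟩
      A ^ L * A ^ (k * L) * (B ^ x * B ^ S) ≡⟨ interchange (A ^ L) (A ^ (k * L)) (B ^ x) (B ^ S) ⟩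
      A ^ L * B ^ x * (A ^ (k * L) * B ^ S) ≤⟨ *-mono-≤ (coordinate-bound x) (weight-bound a) ⟩
      φ x * A ^ x * (weight a * A ^ S)      ≡⟨ interchange (φ x) (A ^ x) (weight a) (A ^ S) ⟩
      φ x * weight a * (A ^ x * A ^ S)      ≡⟨ cong (φ x * weight a *_) (sym (^-distribˡ-+-* A x S)) ⟩
      weight (x ∷ a) * A ^ (x + S)          ∎
      where
      open ≤-Reasoning
      S = Vec.sum a
      interchange : ∀ a b c d → a * b * (c * d) ≡ a * c * (b * d)
      interchange = solve-∀

    c^n≡ : c ^ n ≡ A ^ (n * L) * A ^ (n * L) * B ^ (n * L)
    c^n≡ = trans (^-distribʳ-* (A ^ L * A ^ L) (B ^ L) n)
             (cong₂ _*_ (trans (^-distribʳ-* (A ^ L) (A ^ L) n) (cong₂ _*_ (powL A) (powL A))) (powL B))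
      where
      powL : ∀ x → (x ^ L) ^ n ≡ x ^ (n * L)
      powL x = trans (^-*-assoc x L n) (cong (x ^_) (*-comm L n))

    cube-power : ∀ x s → (x ^ s) ^ 3 ≡ x ^ (3 * s)
    cube-power x s = trans (^-*-assoc x s 3) (cong (x ^_) (*-comm s 3))

    weight-cube : ∀ (a : Vec ℕ n) → IsLow L a → c ^ n ≤ weight a ^ 3
    weight-cube a low = *-cancelʳ-≤ (c ^ n) (weight a ^ 3) (A ^ (3 * S)) {{m^n≢0 A (3 * S)}} (begin
      c ^ n * A ^ (3 * S)                   ≡⟨ cong (_* A ^ (3 * S)) c^n≡ ⟩
      A ^ T * A ^ T * B ^ T * A ^ (3 * S)   ≡⟨ *-assoc (A ^ T * A ^ T) (B ^ T) _ ⟩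
      A ^ T * A ^ T * (B ^ T * A ^ (3 * S)) ≤⟨ *-monoʳ-≤ (A ^ T * A ^ T) (exchangePowers (3 * S) T B≤A low) ⟩
      A ^ T * A ^ T * (A ^ T * B ^ (3 * S)) ≡⟨ cube (A ^ T) (B ^ S) (B ^ (3 * S)) (cube-power B S) ⟩
      (A ^ T * B ^ S) ^ 3                   ≤⟨ ^-monoˡ-≤ 3 (weight-bound a) ⟩
      (weight a * A ^ S) ^ 3                ≡⟨ trans (^-distribʳ-* (weight a) (A ^ S) 3)
                                                     (cong (weight a ^ 3 *_) (cube-power A S)) ⟩
      weight a ^ 3 * A ^ (3 * S)            ∎)
      where
      open ≤-Reasoning
      S = Vec.sum a
      T = n * L
      cube : ∀ x y z → y ^ 3 ≡ z → x * x * (x * z) ≡ (x * y) ^ 3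
      cube x y z refl = cube′ x y
        where
        cube′ : ∀ x y → x * x * (x * (y * (y * (y * 1)))) ≡ (x * y) * ((x * y) * ((x * y) * 1))
        cube′ = solve-∀

    ∑-weights : ∑[ a ∈ allVectors (upTo q) n ] weight a ≡ G ^ n
    ∑-weights = trans (sym (∏∑ₗ≈∑ₗ∏ n (upTo q) (λ _ → φ))) (∏-const n G)

    |I|³cⁿ≤G³ⁿ : length (lowDegreeExponents n L) ^ 3 * c ^ n ≤ (G ^ n) ^ 3
    |I|³cⁿ≤G³ⁿ = ≤-trans
      (length^*≤∑ₗ^ 3 (c ^ n) I weight (All.map (λ {a} → weight-cube a) (all-filter (isLow? L) exponents)))
      (^-monoˡ-≤ 3 (≤-trans (∑ₗ-filter-≤ (isLow? L) exponents weight) (≤-reflexive ∑-weights)))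
      where
      exponents = allVectors (upTo q) n
      I = lowDegreeExponents n L

    count : 32 ^ n * length (lowDegreeExponents n L) ^ 3 ≤ 27 ^ n * q ^ (3 * n)
    count = *-cancelʳ-≤ _ _ (c ^ n) (begin
      32 ^ n * |I| ^ 3 * c ^ n        ≡⟨ *-assoc (32 ^ n) _ _ ⟩
      32 ^ n * (|I| ^ 3 * c ^ n)      ≤⟨ *-monoʳ-≤ (32 ^ n) |I|³cⁿ≤G³ⁿ ⟩
      32 ^ n * (G ^ n) ^ 3            ≡⟨ cong (32 ^ n *_) (trans (cube-power G n) (sym (^-*-assoc G 3 n))) ⟩
      32 ^ n * (G ^ 3) ^ n            ≡⟨ sym (^-distribʳ-* 32 (G ^ 3) n) ⟩
      (32 * G ^ 3) ^ n                ≤⟨ ^-monoˡ-≤ n 32G³≤27q³c ⟩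
      (27 * (q ^ 3 * c)) ^ n          ≡⟨ trans (^-distribʳ-* 27 _ n) (cong (27 ^ n *_) (^-distribʳ-* (q ^ 3) c n)) ⟩
      27 ^ n * ((q ^ 3) ^ n * c ^ n)  ≡⟨ trans (sym (*-assoc (27 ^ n) _ _)) (cong (λ x → 27 ^ n * x * c ^ n) (^-*-assoc q 3 n)) ⟩
      27 ^ n * q ^ (3 * n) * c ^ n    ∎)
      where
      open ≤-Reasoning
      |I| = length (lowDegreeExponents n L)

module SumFreeTensor where

  open import Data.Empty using (⊥; ⊥-elim)
  open import Data.Fin.Base using (Fin; zero; suc; toℕ)
  open import Data.Fin.Properties using (_≟_; toℕ-fromℕ<)
  open import Data.Integer.Base using (ℤ; 1ℤ; 0ℤ; _*_)
  import Data.Integer.Properties as ℤ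
  open import Data.List.Base as List using (List; upTo; length)
  open import Data.List.Membership.Propositional using (_∈_)
  open import Data.List.Membership.Propositional.Properties using (∈-filter⁺; ∈-upTo⁺)
  import Data.List.Relation.Unary.Any as Any
  open import Data.List.Relation.Unary.Any.Properties using (lookup-index)
  open import Data.Nat.Base as ℕ using (ℕ; zero; suc; _≤_; _^_; s≤s)
  open import Data.Nat.DivMod using (_%_; %-distribˡ-+; m%n%n≡m%n)
  open import Data.Nat.Primality using (Prime)
  import Data.Nat.Properties as ℕ
  open import Data.Nat.Tactic.RingSolver as ℕ-Solver using ()
  open import Data.Product using (_,_; proj₁; proj₂; Σ-syntax)
  open import Data.Sum using (_⊎_; inj₁; inj₂)
  open import Data.Vec.Base as Vec using (Vec; []; _∷_; lookup)
  open import Data.Vec.Functional using (Vector)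
  open import Data.Vec.Properties using (lookup-map; lookup-zipWith)
  open import Data.Vec.Relation.Unary.All using ([]; _∷_)
  open import Function.Base using (_∘_)
  open import Relation.Binary.PropositionalEquality as ≡ using (_≡_; refl; sym; trans; cong; cong₂; subst; subst₂)
  open import Relation.Nullary using (¬_; yes; no; contradiction)

  open import Defs
  open AllVectors
  open FiniteSums ℤ.+-*-commutativeSemiring
  open IntegerSums using (_≡_mod_; ≡-mod-sym; ∏-cong-mod)
  open SliceRank
  open Binomials
  open ExponentCounting using (IsLow; isLow?; lowDegreeExponents)

  toℕ-+ᶻ : ∀ {q} (x y : Fin (suc q)) → toℕ (x +ᶻ y) ≡ (toℕ x ℕ.+ toℕ y) % suc q
  toℕ-+ᶻ x y = toℕ-fromℕ< _

  ∏-zeroIndicator-IsZero : ∀ {q n} (v : Vec (Fin q) n) → IsZero v →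
                           ∏[ r < n ] zeroIndicator (toℕ (lookup v r)) ≡ 1ℤ
  ∏-zeroIndicator-IsZero []      []          = refl
  ∏-zeroIndicator-IsZero (x ∷ v) (x≡0 ∷ v≡0) rewrite x≡0 = trans (ℤ.*-identityˡ _) (∏-zeroIndicator-IsZero v v≡0)

  ∏-zeroIndicator-¬IsZero : ∀ {q n} (v : Vec (Fin q) n) → ¬ IsZero v →
                            ∏[ r < n ] zeroIndicator (toℕ (lookup v r)) ≡ 0ℤ
  ∏-zeroIndicator-¬IsZero []      v≢0 = contradiction [] v≢0
  ∏-zeroIndicator-¬IsZero (x ∷ v) v≢0 with toℕ x in x≡
  ... | suc _ = refl
  ... | zero  = trans (ℤ.*-identityˡ _) (∏-zeroIndicator-¬IsZero v (v≢0 ∘ (x≡ ∷_)))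

  noneBelowThird : ∀ a b c {T} → a ℕ.+ b ℕ.+ c ≡ T → ¬ 3 ℕ.* a ≤ T → ¬ 3 ℕ.* b ≤ T → ¬ 3 ℕ.* c ≤ T → ⊥
  noneBelowThird a b c refl 3a≰T 3b≰T 3c≰T = ℕ.<-irrefl (thrice a b c)
    (ℕ.+-mono-< (ℕ.+-mono-< (ℕ.≰⇒> 3a≰T) (ℕ.≰⇒> 3b≰T)) (ℕ.≰⇒> 3c≰T))
    where
    thrice : ∀ a b c → a ℕ.+ b ℕ.+ c ℕ.+ (a ℕ.+ b ℕ.+ c) ℕ.+ (a ℕ.+ b ℕ.+ c) ≡ 3 ℕ.* a ℕ.+ 3 ℕ.* b ℕ.+ 3 ℕ.* c
    thrice = ℕ-Solver.solve-∀

  module _ {L : ℕ} where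

    exponents₁ exponents₂ exponents₃ : ∀ {n} → Vec (Triple L) n → Vec ℕ n
    exponents₁ = Vec.map Triple.a
    exponents₂ = Vec.map Triple.b
    exponents₃ = Vec.map Triple.c

    exponents-total : ∀ {n} (μ : Vec (Triple L) n) →
                      Vec.sum (exponents₁ μ) ℕ.+ Vec.sum (exponents₂ μ) ℕ.+ Vec.sum (exponents₃ μ) ≡ n ℕ.* L
    exponents-total []                         = refl
    exponents-total (triple a b c a+b+c≡L ∷ μ) =
      trans (interchange a b c (Vec.sum (exponents₁ μ)) (Vec.sum (exponents₂ μ)) (Vec.sum (exponents₃ μ)))
            (cong₂ ℕ._+_ a+b+c≡L (exponents-total μ))
      where
      interchange : ∀ a b c x y z → a ℕ.+ x ℕ.+ (b ℕ.+ y) ℕ.+ (c ℕ.+ z) ≡ a ℕ.+ (b ℕ.+ c) ℕ.+ (x ℕ.+ y ℕ.+ z)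
      interchange = ℕ-Solver.solve-∀

    someLow : ∀ {n} (μ : Vec (Triple L) n) → IsLow L (exponents₁ μ) ⊎ IsLow L (exponents₂ μ) ⊎ IsLow L (exponents₃ μ)
    someLow μ with isLow? L (exponents₁ μ) | isLow? L (exponents₂ μ) | isLow? L (exponents₃ μ)
    ... | yes low  | _        | _        = inj₁ low
    ... | no _     | yes low  | _        = inj₂ (inj₁ low)
    ... | no _     | no _     | yes low  = inj₂ (inj₂ low)
    ... | no high₁ | no high₂ | no high₃ = ⊥-elim
      (noneBelowThird (Vec.sum (exponents₁ μ)) (Vec.sum (exponents₂ μ)) (Vec.sum (exponents₃ μ))
                      (exponents-total μ) high₁ high₂ high₃)

    exponents-≤ : ∀ {n} (exponent : Triple L → ℕ) → (∀ τ → exponent τ ≤ L) →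
                  ∀ (μ : Vec (Triple L) n) r → lookup (Vec.map exponent μ) r ≤ L
    exponents-≤ exponent exponent≤L μ r = subst (_≤ L) (sym (lookup-map r exponent μ)) (exponent≤L (lookup μ r))

    lowDegree-index : ∀ {n} (a : Vec ℕ n) → (∀ r → lookup a r ≤ L) → IsLow L a →
                      Σ[ r ∈ Fin (length (lowDegreeExponents n L)) ] List.lookup (lowDegreeExponents n L) r ≡ a
    lowDegree-index {n} a a≤L low = Any.index a∈ , sym (lookup-index a∈)
      where
      a∈ : a ∈ lowDegreeExponents n L
      a∈ = ∈-filter⁺ (isLow? L) (∈-allVectors⁺ (upTo (suc L)) a (λ r → ∈-upTo⁺ (s≤s (a≤L r)))) low

  module SumFreeSet {p e L n m} (p-prime : Prime p) (q≡p^[1+e] : suc L ≡ p ^ suc e)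
                    (M : TricoloredSumFree (suc L) n m) where

    open TricoloredSumFree M
    open ModPrime p-prime using (sliceRank-diagonal)

    q : ℕ
    q = suc L

    coord : H q n → Fin n → ℕ
    coord x r = toℕ (lookup x r)

    coord-+ᴴ : ∀ x y z r → coord ((x +ᴴ y) +ᴴ z) r ≡ (coord x r ℕ.+ coord y r ℕ.+ coord z r) % q
    coord-+ᴴ x y z r = begin
      toℕ (lookup ((x +ᴴ y) +ᴴ z) r)
        ≡⟨ cong toℕ (lookup-zipWith _+ᶻ_ r (x +ᴴ y) z) ⟩
      toℕ (lookup (x +ᴴ y) r +ᶻ lookup z r)
        ≡⟨ toℕ-+ᶻ (lookup (x +ᴴ y) r) (lookup z r) ⟩
      (toℕ (lookup (x +ᴴ y) r) ℕ.+ zᵣ) % q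
        ≡⟨ cong (λ w → (toℕ w ℕ.+ zᵣ) % q) (lookup-zipWith _+ᶻ_ r x y) ⟩
      (toℕ (lookup x r +ᶻ lookup y r) ℕ.+ zᵣ) % q
        ≡⟨ cong (λ w → (w ℕ.+ zᵣ) % q) (toℕ-+ᶻ (lookup x r) (lookup y r)) ⟩
      ((xᵣ ℕ.+ yᵣ) % q ℕ.+ zᵣ) % q
        ≡⟨ %-distribˡ-+ ((xᵣ ℕ.+ yᵣ) % q) zᵣ q ⟩
      ((xᵣ ℕ.+ yᵣ) % q % q ℕ.+ zᵣ % q) % q
        ≡⟨ cong (λ w → (w ℕ.+ zᵣ % q) % q) (m%n%n≡m%n (xᵣ ℕ.+ yᵣ) q) ⟩
      ((xᵣ ℕ.+ yᵣ) % q ℕ.+ zᵣ % q) % q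
        ≡⟨ sym (%-distribˡ-+ (xᵣ ℕ.+ yᵣ) zᵣ q) ⟩
      (xᵣ ℕ.+ yᵣ ℕ.+ zᵣ) % q ∎
      where
      open ≡.≡-Reasoning
      xᵣ = coord x r
      yᵣ = coord y r
      zᵣ = coord z r

    diagonal-indicator : ∀ i j k → diagonal i j k ≡ ∏[ r < n ] zeroIndicator (coord ((s i +ᴴ t j) +ᴴ u k) r)
    diagonal-indicator i j k with j ≟ i | j ≟ k
    ... | yes refl | yes refl = trans (cong₂ _*_ (δ-refl j) (δ-refl j))
                                      (sym (∏-zeroIndicator-IsZero _ (sum-in j)))
    ... | yes refl | no j≢k   = trans (cong₂ _*_ (δ-refl j) (δ-≢ j≢k))
                                      (sym (∏-zeroIndicator-¬IsZero _ (j≢k ∘ proj₂ ∘ sum-out j j k)))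
    ... | no j≢i   | _        = trans (cong (_* δ j k) (δ-≢ j≢i))
                                      (sym (∏-zeroIndicator-¬IsZero _ (j≢i ∘ sym ∘ proj₁ ∘ sum-out i j k)))

    -- The z-coordinates are shifted by L, turning ∏ (w + L choose L) into the form of the trinomial identity.
    monomial : ℕ → Vec ℕ n → H q n → ℤ
    monomial shift a x = ∏[ r < n ] ((coord x r ℕ.+ shift) Cᶻ lookup a r)

    monomials : List (Vec (Triple L) n)
    monomials = allVectors (triples L) n

    monomial-map : ∀ shift (exponent : Triple L → ℕ) μ x →
                   monomial shift (Vec.map exponent μ) x ≡ ∏[ r < n ] ((coord x r ℕ.+ shift) Cᶻ exponent (lookup μ r))
    monomial-map shift exponent μ x = ∏-cong (λ r → cong ((coord x r ℕ.+ shift) Cᶻ_) (lookup-map r exponent μ))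

    expansion : ∀ x y z →
      ∏[ r < n ] ((coord x r ℕ.+ coord y r ℕ.+ coord z r ℕ.+ L) Cᶻ L) ≡
      ∑[ μ ∈ monomials ] (monomial 0 (exponents₁ μ) x * monomial 0 (exponents₂ μ) y * monomial L (exponents₃ μ) z)
    expansion x y z = begin
      ∏[ r < n ] ((coord x r ℕ.+ coord y r ℕ.+ coord z r ℕ.+ L) Cᶻ L)
        ≡⟨ ∏-cong (λ r → sym (trans (trinomial (coord x r ℕ.+ 0) (coord y r ℕ.+ 0) (coord z r ℕ.+ L) L)
                                     (cong (_Cᶻ L) (regroup (coord x r) (coord y r) (coord z r) L)))) ⟩
      ∏[ r < n ] ∑[ τ ∈ triples L ] term r τ
        ≡⟨ ∏∑ₗ≈∑ₗ∏ n (triples L) term ⟩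
      ∑[ μ ∈ monomials ] ∏[ r < n ] term r (lookup μ r)
        ≡⟨ ∑ₗ-cong monomials (λ μ → trans (∏-distrib-* {n} _ _) (cong (_* _) (∏-distrib-* {n} _ _))) ⟩
      ∑[ μ ∈ monomials ] (∏[ r < n ] ((coord x r ℕ.+ 0) Cᶻ Triple.a (lookup μ r)) *
                          ∏[ r < n ] ((coord y r ℕ.+ 0) Cᶻ Triple.b (lookup μ r)) *
                          ∏[ r < n ] ((coord z r ℕ.+ L) Cᶻ Triple.c (lookup μ r)))
        ≡⟨ ∑ₗ-cong monomials (λ μ → sym (cong₂ _*_ (cong₂ _*_ (monomial-map 0 Triple.a μ x)
                                                              (monomial-map 0 Triple.b μ y))
                                                   (monomial-map L Triple.c μ z))) ⟩
      ∑[ μ ∈ monomials ] (monomial 0 (exponents₁ μ) x * monomial 0 (exponents₂ μ) y * monomial L (exponents₃ μ) z) ∎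
      where
      open ≡.≡-Reasoning
      term : Fin n → Triple L → ℤ
      term r τ = (coord x r ℕ.+ 0) Cᶻ Triple.a τ * (coord y r ℕ.+ 0) Cᶻ Triple.b τ * (coord z r ℕ.+ L) Cᶻ Triple.c τ
      regroup : ∀ x y z L → x ℕ.+ 0 ℕ.+ (y ℕ.+ 0 ℕ.+ (z ℕ.+ L)) ≡ x ℕ.+ y ℕ.+ z ℕ.+ L
      regroup = ℕ-Solver.solve-∀

    x-part y-part z-part : Vec (Triple L) n → Vector ℤ m
    x-part μ i = monomial 0 (exponents₁ μ) (s i)
    y-part μ j = monomial 0 (exponents₂ μ) (t j)
    z-part μ k = monomial L (exponents₃ μ) (u k)

    diagonal≡expansion : ∀ i j k →
                         diagonal i j k ≡ ∑[ μ ∈ monomials ] (x-part μ i * y-part μ j * z-part μ k) mod p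
    diagonal≡expansion i j k = subst₂ (_≡_mod p) (sym (diagonal-indicator i j k)) (expansion x y z)
      (∏-cong-mod indicator binomial (λ r → ≡-mod-sym {x = binomial r} {y = indicator r}
        (subst (λ c → binomial r ≡ zeroIndicator c mod p) (sym (coord-+ᴴ x y z r))
               (binomial-indicator p-prime e L q≡p^[1+e] (w r)))))
      where
      x = s i
      y = t j
      z = u k
      w : Fin n → ℕ
      w r = coord x r ℕ.+ coord y r ℕ.+ coord z r
      indicator binomial : Fin n → ℤ
      indicator r = zeroIndicator (coord ((x +ᴴ y) +ᴴ z) r)
      binomial  r = (w r ℕ.+ L) Cᶻ L

    N : ℕ
    N = length (lowDegreeExponents n L)

    X Y W : Fin N → Vector ℤ m
    X r i = monomial 0 (List.lookup (lowDegreeExponents n L) r) (s i)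
    Y r j = monomial 0 (List.lookup (lowDegreeExponents n L) r) (t j)
    W r k = monomial L (List.lookup (lowDegreeExponents n L) r) (u k)

    tag : ∀ μ → SliceTag X Y W (x-part μ) (y-part μ) (z-part μ)
    tag μ with someLow μ
    ... | inj₁ low with r , a≡ ← lowDegree-index (exponents₁ μ) (exponents-≤ Triple.a a≤L μ) low =
      first r (λ i → cong (λ a → monomial 0 a (s i)) a≡)
    ... | inj₂ (inj₁ low) with r , b≡ ← lowDegree-index (exponents₂ μ) (exponents-≤ Triple.b b≤L μ) low =
      second r (λ j → cong (λ b → monomial 0 b (t j)) b≡)
    ... | inj₂ (inj₂ low) with r , c≡ ← lowDegree-index (exponents₃ μ) (exponents-≤ Triple.c c≤L μ) low =
      third r (λ k → cong (λ c → monomial L c (u k)) c≡)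

    m≤3N : m ≤ N ℕ.+ N ℕ.+ N
    m≤3N = sliceRank-diagonal grouped
      (λ i j k → subst (λ T → diagonal i j k ≡ T mod p) (grouped-tensor i j k) (diagonal≡expansion i j k))
      where open SliceGrouping monomials x-part y-part z-part X Y W tag

open import Data.List.Base using (length)
open import Data.Nat.Base using (ℕ; zero; suc; _+_; _*_; _^_; _≤_; _<_; s≤s; nonTrivial⇒n>1)
open import Data.Nat.Primality using (prime⇒nonTrivial; prime⇒nonZero)
open import Data.Nat.Properties using (≤-trans; *-monoʳ-≤; ^-monoˡ-≤; m≤m*n; m^n≢0; module ≤-Reasoning)
open import Data.Nat.Tactic.RingSolver using (solve-∀)
open import Data.Product using (_,_)
open import Relation.Binary.PropositionalEquality using (_≡_; refl)
open import Relation.Nullary using (contradiction)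
open import Defs
open ExponentCounting using (lowDegreeExponents; module LowDegreeCount)
open SumFreeTensor using (module SumFreeSet)

IsPrimePower⇒1<q : ∀ {q} → IsPrimePower q → 1 < q
IsPrimePower⇒1<q (p , e , p-prime , refl) =
  ≤-trans (nonTrivial⇒n>1 p {{prime⇒nonTrivial p-prime}}) (m≤m*n p (p ^ e) {{m^n≢0 p e {{prime⇒nonZero p-prime}}}})

mainTheorem2 : (q : ℕ) → IsPrimePower q → (n m : ℕ) → TricoloredSumFree q n m →
    32 ^ n * m ^ 3 ≤ 27 * (27 ^ n * q ^ (3 * n))
mainTheorem2 zero           q-prime-power _ _ _ = contradiction (IsPrimePower⇒1<q q-prime-power) λ ()
mainTheorem2 (suc zero)     q-prime-power _ _ _ = contradiction (IsPrimePower⇒1<q q-prime-power) λ { (s≤s ()) }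
mainTheorem2 (suc (suc L′)) (p , e , p-prime , q≡p^[1+e]) n m M = begin
  32 ^ n * m ^ 3                         ≤⟨ *-monoʳ-≤ (32 ^ n) (^-monoˡ-≤ 3 (SumFreeSet.m≤3N {e = e} p-prime q≡p^[1+e] M)) ⟩
  32 ^ n * (N + N + N) ^ 3               ≡⟨ cube-of-triple (32 ^ n) N ⟩
  27 * (32 ^ n * N ^ 3)                  ≤⟨ *-monoʳ-≤ 27 (LowDegreeCount.count L′ n) ⟩
  27 * (27 ^ n * suc (suc L′) ^ (3 * n)) ∎
  where
  open ≤-Reasoning
  N = length (lowDegreeExponents n (suc L′))
  cube-of-triple : ∀ x N → x * ((N + N + N) * ((N + N + N) * ((N + N + N) * 1))) ≡ 27 * (x * (N * (N * (N * 1))))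
  cube-of-triple = solve-∀
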